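{- Let $n\ge1$ and let $\mathcal{C}_n$ be the set of corner-sum hypermatrices of order $n$, ordered by entrywise comparison. Then $\mathcal{C}_n$ is graded and its rank (the length of any maximal chain) equals \[\frac{9n^5-10n^3+4^{1+(-1)^n}n}{240}.\]
   Context: A corner-sum hypermatrix of order $n$ is an $(n+1)\times(n+1)\times(n+1)$ integer array $C$ indexed by $[0,n]^3$ with $C_{i,j,0}=C_{i,0,j}=C_{0,i,j}=0$ and $C_{i,j,n}=C_{i,n,j}=C_{n,i,j}=ij$ for all $i,j\in[0,n]$, and such that for all $i,j\in[0,n]$, $1\le k\le n$, each of $C_{i,j,k}-C_{i,j,k-1}$, $C_{i,k,j}-C_{i,k-1,j}$, $C_{k,i,j}-C_{k-1,i,j}$ lies in $\{\max(0,i+j-n),\dots,\min(i,j)\}$. -}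

module Defs where

open import Data.Nat as ℕ using (ℕ; zero; suc; _∸_; _⊓_)
open import Data.Integer as ℤ using (ℤ; +_; -_; _-_; ∣_∣)
open import Data.Fin using (Fin; toℕ; fromℕ; inject₁) renaming (zero to fzero; suc to fsuc)
open import Data.Product using (_×_; Σ)
open import Data.List using (List; length)
open import Data.List.Relation.Unary.All using (All)
open import Data.List.Relation.Unary.Any using (Any)
open import Data.List.Relation.Binary.Pointwise using ()
open import Data.List.Relation.Unary.Linked using (Linked)
open import Data.Sum using (_⊎_)
open import Relation.Binary.PropositionalEquality using (_≡_)
open import Relation.Nullary using (¬_)

HyperMatrix : ℕ → Set
HyperMatrix n = Fin (suc n) → Fin (suc n) → Fin (suc n) → ℤ

InRange : ℕ → ℕ → ℕ → ℤ → Set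
InRange n i j d = (+ ((i ℕ.+ j) ∸ n) ℤ.≤ d) × (d ℤ.≤ + (i ⊓ j))

record IsCornerSum (n : ℕ) (C : HyperMatrix n) : Set where
  field
    zero₃ : ∀ i j → C i j fzero ≡ + 0
    zero₂ : ∀ i j → C i fzero j ≡ + 0
    zero₁ : ∀ i j → C fzero i j ≡ + 0
    top₃  : ∀ i j → C i j (fromℕ n) ≡ + (toℕ i ℕ.* toℕ j)
    top₂  : ∀ i j → C i (fromℕ n) j ≡ + (toℕ i ℕ.* toℕ j)
    top₁  : ∀ i j → C (fromℕ n) i j ≡ + (toℕ i ℕ.* toℕ j)
    -- k ranges over 1..n as fsuc k, with k-1 = inject₁ k
    step₃ : ∀ i j (k : Fin n) →
      InRange n (toℕ i) (toℕ j) (C i j (fsuc k) - C i j (inject₁ k))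
    step₂ : ∀ i j (k : Fin n) →
      InRange n (toℕ i) (toℕ j) (C i (fsuc k) j - C i (inject₁ k) j)
    step₁ : ∀ i j (k : Fin n) →
      InRange n (toℕ i) (toℕ j) (C (fsuc k) i j - C (inject₁ k) i j)

_≤ᴴ_ : ∀ {n} → HyperMatrix n → HyperMatrix n → Set
C ≤ᴴ D = ∀ i j k → C i j k ℤ.≤ D i j k

_≈ᴴ_ : ∀ {n} → HyperMatrix n → HyperMatrix n → Set
C ≈ᴴ D = ∀ i j k → C i j k ≡ D i j k

_<ᴴ_ : ∀ {n} → HyperMatrix n → HyperMatrix n → Set
C <ᴴ D = C ≤ᴴ D × ¬ (D ≤ᴴ C)

record IsChain (n : ℕ) (cs : List (HyperMatrix n)) : Set where
  field
    members    : All (IsCornerSum n) cs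
    increasing : Linked _<ᴴ_ cs

record IsMaximalChain (n : ℕ) (cs : List (HyperMatrix n)) : Set where
  field
    chain   : IsChain n cs
    maximal : ∀ D → IsCornerSum n D →
              All (λ x → x ≤ᴴ D ⊎ D ≤ᴴ x) cs → Any (λ x → x ≈ᴴ D) cs

chainLength : ∀ {n} → List (HyperMatrix n) → ℕ
chainLength cs = length cs ∸ 1

GradedOfRank : ℕ → ℕ → Set
GradedOfRank n r =
  Σ (List (HyperMatrix n)) (λ cs → IsMaximalChain n cs × chainLength cs ≡ r)
  × (∀ cs → IsMaximalChain n cs → chainLength cs ≡ r)

rankNumerator : ℕ → ℤ
rankNumerator n =
  + 9 ℤ.* (+ n) ℤ.^ 5 - + 10 ℤ.* (+ n) ℤ.^ 3
  ℤ.+ (+ 4) ℤ.^ ∣ + 1 ℤ.+ (- + 1) ℤ.^ n ∣ ℤ.* + n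

module Submission where

module Sums where

  open import Data.Nat as ℕ using (ℕ; zero; suc; _∸_)
  import Data.Nat.Properties as ℕP
  open import Data.Integer as ℤ using (ℤ; +_; -_; _-_; _+_; _*_; 0ℤ; 1ℤ; -1ℤ; _≤_; _<_)
  import Data.Integer.Properties as ℤP
  open import Data.Integer.Tactic.RingSolver using (solve-∀)
  open import Data.Product using (Σ-syntax; _×_; _,_)
  open import Data.Sum using (inj₁; inj₂)
  open import Relation.Nullary using (¬_; yes; no)
  open import Relation.Binary.PropositionalEquality
  open ≡-Reasoning

  ∑ : ℕ → (ℕ → ℤ) → ℤ
  ∑ zero    f = 0ℤ
  ∑ (suc m) f = ∑ m f + f m

  syntax ∑ m (λ k → e) = ∑[ k < m ] e

  private
    variable
      m : ℕ
      f g : ℕ → ℤ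

  ∑-cong : (∀ k → k ℕ.< m → f k ≡ g k) → ∑ m f ≡ ∑ m g
  ∑-cong {zero}  eq = refl
  ∑-cong {suc m} eq = cong₂ _+_ (∑-cong (λ k k<m → eq k (ℕP.m<n⇒m<1+n k<m))) (eq m ℕP.≤-refl)

  ∑-mono-≤ : (∀ k → k ℕ.< m → f k ≤ g k) → ∑ m f ≤ ∑ m g
  ∑-mono-≤ {zero}  le = ℤP.≤-refl
  ∑-mono-≤ {suc m} le = ℤP.+-mono-≤ (∑-mono-≤ (λ k k<m → le k (ℕP.m<n⇒m<1+n k<m))) (le m ℕP.≤-refl)

  ∑-distrib-+ : ∀ m f g → ∑[ k < m ] (f k + g k) ≡ ∑ m f + ∑ m g
  ∑-distrib-+ zero    f g = refl
  ∑-distrib-+ (suc m) f g = begin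
    ∑[ k < m ] (f k + g k) + (f m + g m) ≡⟨ cong (_+ (f m + g m)) (∑-distrib-+ m f g) ⟩
    ∑ m f + ∑ m g + (f m + g m)          ≡⟨ interchange (∑ m f) (∑ m g) (f m) (g m) ⟩
    ∑ m f + f m + (∑ m g + g m)          ∎
    where
    interchange : ∀ a b c d → a + b + (c + d) ≡ a + c + (b + d)
    interchange = solve-∀

  *-distribˡ-∑ : ∀ c m f → c * ∑ m f ≡ ∑[ k < m ] (c * f k)
  *-distribˡ-∑ c zero    f = ℤP.*-zeroʳ c
  *-distribˡ-∑ c (suc m) f = begin
    c * (∑ m f + f m)       ≡⟨ ℤP.*-distribˡ-+ c (∑ m f) (f m) ⟩
    c * ∑ m f + c * f m     ≡⟨ cong (_+ c * f m) (*-distribˡ-∑ c m f) ⟩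
    ∑[ k < m ] (c * f k) + c * f m ∎

  ∑-distrib-- : ∀ m f g → ∑[ k < m ] (f k - g k) ≡ ∑ m f - ∑ m g
  ∑-distrib-- m f g = begin
    ∑[ k < m ] (f k - g k)        ≡⟨ ∑-distrib-+ m f (λ k → - g k) ⟩
    ∑ m f + ∑[ k < m ] (- g k)    ≡⟨ cong (λ z → ∑ m f + z) (∑-cong {m} (λ k _ → sym (ℤP.-1*i≡-i (g k)))) ⟩
    ∑ m f + ∑[ k < m ] (-1ℤ * g k) ≡⟨ cong (λ z → ∑ m f + z) (sym (*-distribˡ-∑ -1ℤ m g)) ⟩
    ∑ m f + -1ℤ * ∑ m g           ≡⟨ cong (λ z → ∑ m f + z) (ℤP.-1*i≡-i (∑ m g)) ⟩
    ∑ m f - ∑ m g                 ∎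

  ∑-const : ∀ m c → ∑[ _ < m ] c ≡ + m * c
  ∑-const zero    c = sym (ℤP.*-zeroˡ c)
  ∑-const (suc m) c = begin
    ∑[ _ < m ] c + c ≡⟨ cong (_+ c) (∑-const m c) ⟩
    + m * c + c      ≡⟨ step (+ m) c ⟩
    + suc m * c      ∎
    where
    step : ∀ x c → x * c + c ≡ (1ℤ + x) * c
    step = solve-∀

  ∑-zero : (∀ k → k ℕ.< m → f k ≡ 0ℤ) → ∑ m f ≡ 0ℤ
  ∑-zero {m} {f} f≡0 = trans (∑-cong f≡0) (trans (∑-const m 0ℤ) (ℤP.*-zeroʳ (+ m)))

  ∑-split : ∀ l m f → ∑ (l ℕ.+ m) f ≡ ∑ l f + ∑[ t < m ] f (l ℕ.+ t)
  ∑-split l zero    f rewrite ℕP.+-identityʳ l = sym (ℤP.+-identityʳ (∑ l f))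
  ∑-split l (suc m) f rewrite ℕP.+-suc l m = begin
    ∑ (l ℕ.+ m) f + f (l ℕ.+ m)                          ≡⟨ cong (_+ f (l ℕ.+ m)) (∑-split l m f) ⟩
    ∑ l f + ∑[ t < m ] f (l ℕ.+ t) + f (l ℕ.+ m)         ≡⟨ ℤP.+-assoc (∑ l f) _ _ ⟩
    ∑ l f + (∑[ t < m ] f (l ℕ.+ t) + f (l ℕ.+ m))       ∎

  ∑-reverse : ∀ m f → ∑[ k < m ] f (m ∸ suc k) ≡ ∑ m f
  ∑-reverse zero    f = refl
  ∑-reverse (suc m) f = begin
    ∑[ k < suc m ] f (suc m ∸ suc k)     ≡⟨ ∑-split 1 m (λ k → f (suc m ∸ suc k)) ⟩
    0ℤ + f m + ∑[ k < m ] f (m ∸ suc k)  ≡⟨ cong₂ _+_ (ℤP.+-identityˡ (f m)) (∑-reverse m f) ⟩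
    f m + ∑ m f                          ≡⟨ ℤP.+-comm (f m) (∑ m f) ⟩
    ∑ m f + f m                          ∎

  telescope : ∀ {F : ℤ → ℤ} (P : ℤ → ℤ) → P 0ℤ ≡ 0ℤ → (∀ x → F x ≡ P (1ℤ + x) - P x) → ∀ m → ∑[ t < m ] F (+ t) ≡ P (+ m)
  telescope P P0≡0 Δ zero    = sym P0≡0
  telescope {F} P P0≡0 Δ (suc m) = begin
    ∑[ t < m ] F (+ t) + F (+ m)        ≡⟨ cong₂ _+_ (telescope {F} P P0≡0 Δ m) (Δ (+ m)) ⟩
    P (+ m) + (P (+ suc m) - P (+ m))   ≡⟨ cancel (P (+ m)) (P (+ suc m)) ⟩
    P (+ suc m)                         ∎
    where
    cancel : ∀ x y → x + (y - x) ≡ y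
    cancel = solve-∀

  ∑-mono-< : (∀ k → k ℕ.< m → f k ≤ g k) → ∀ {j} → j ℕ.< m → f j < g j → ∑ m f < ∑ m g
  ∑-mono-< {suc m} le {j} j<1+m fj<gj with ℕP.m<1+n⇒m<n∨m≡n j<1+m
  ... | inj₁ j<m  = ℤP.+-mono-<-≤ (∑-mono-< (λ k k<m → le k (ℕP.m<n⇒m<1+n k<m)) j<m fj<gj) (le m ℕP.≤-refl)
  ... | inj₂ refl = ℤP.+-mono-≤-< (∑-mono-≤ (λ k k<m → le k (ℕP.m<n⇒m<1+n k<m))) fj<gj

  ∑-≡⇒pointwise-≡ : (∀ k → k ℕ.< m → f k ≤ g k) → ∑ m f ≡ ∑ m g → ∀ k → k ℕ.< m → f k ≡ g k
  ∑-≡⇒pointwise-≡ le eq k k<m =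
    ℤP.≤-antisym (le k k<m) (ℤP.≮⇒≥ (λ fk<gk → ℤP.<-irrefl eq (∑-mono-< le k<m fk<gk)))

  ∑-<⇒∃< : (∀ k → k ℕ.< m → f k ≤ g k) → ∑ m f < ∑ m g → Σ[ k ∈ ℕ ] k ℕ.< m × f k < g k
  ∑-<⇒∃< {zero}          le (ℤ.+<+ ())
  ∑-<⇒∃< {suc m} {f} {g} le lt with f m ℤP.<? g m
  ... | yes fm<gm = m , ℕP.≤-refl , fm<gm
  ... | no fm≮gm with ∑-<⇒∃< le′ (ℤP.≰⇒> ∑g≰∑f)
    where
    le′ : ∀ k → k ℕ.< m → f k ≤ g k
    le′ k k<m = le k (ℕP.m<n⇒m<1+n k<m)
    ∑g≰∑f : ¬ (∑ m g ≤ ∑ m f)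
    ∑g≰∑f ∑g≤∑f = ℤP.<⇒≱ lt (ℤP.+-mono-≤ ∑g≤∑f (ℤP.≮⇒≥ fm≮gm))
  ... | k , k<m , fk<gk = k , ℕP.m<n⇒m<1+n k<m , fk<gk

module TruncatedSubtraction where

  open import Data.Nat
  open import Data.Nat.Properties
  open import Data.Nat.Tactic.RingSolver using (solve-∀)
  open import Data.Product using (Σ-syntax; _,_)
  open import Data.Sum using (inj₁; inj₂)
  open import Relation.Nullary using (¬_; yes; no)
  open import Relation.Binary.PropositionalEquality

  ≤-split : ∀ {x y} → x ≤ y → Σ[ d ∈ ℕ ] y ≡ x + d
  ≤-split {x} {y} x≤y = y ∸ x , sym (m+[n∸m]≡n x≤y)

  ∸-by : ∀ {x} n {d} → x ≡ n + d → x ∸ n ≡ d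
  ∸-by n {d} refl = m+n∸m≡n n d

  ≤-by : ∀ {x y} d → x + d ≡ y → x ≤ y
  ≤-by {x} d refl = m≤m+n x d

  ≰⇒overshoot : ∀ {x k e} → ¬ (x + k ≤ k + e) → e ≤ x
  ≰⇒overshoot {x} {k} {e} x+k≰k+e = <⇒≤ (+-cancelˡ-< k e x (subst (k + e <_) (+-comm x k) (≰⇒> x+k≰k+e)))

  exchange : ∀ e y z → (e + y + z) * y ≤ (e + y) * (y + z)
  exchange e y z = ≤-by (e * z) (expand e y z)
    where
    expand : ∀ e y z → (e + y + z) * y + e * z ≡ (e + y) * (y + z)
    expand = solve-∀

  excess≤ : ∀ a {b n} → b ≤ n → a + b ∸ n ≤ a
  excess≤ a {b} b≤n = ≤-trans (∸-monoʳ-≤ (a + b) b≤n) (≤-reflexive (m+n∸n≡m a b))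

  suc-∸-≤ : ∀ x n → suc x ∸ n ≤ suc (x ∸ n)
  suc-∸-≤ x n = m≤n+o⇒m∸n≤o (suc x) n (subst (suc x ≤_) (sym (+-suc n (x ∸ n))) (s≤s (m≤n+m∸n x n)))

  i+j∸n≡i∸[n∸j] : ∀ i {j n} → j ≤ n → i + j ∸ n ≡ i ∸ (n ∸ j)
  i+j∸n≡i∸[n∸j] i {j} j≤n with ≤-split j≤n
  ... | e , refl rewrite m+n∸m≡n j e | +-comm i j = [m+n]∸[m+o]≡n∸o j i e

  i⊓[n∸j]+[i+j∸n]≡i : ∀ i {j n} → j ≤ n → i ⊓ (n ∸ j) + (i + j ∸ n) ≡ i
  i⊓[n∸j]+[i+j∸n]≡i i {j} {n} j≤n
    rewrite i+j∸n≡i∸[n∸j] i j≤n | ⊓-comm i (n ∸ j) = m⊓n+n∸m≡n (n ∸ j) i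

  i+[n∸j]∸n≡i∸j : ∀ i {j n} → j ≤ n → i + (n ∸ j) ∸ n ≡ i ∸ j
  i+[n∸j]∸n≡i∸j i {j} {n} j≤n = trans (i+j∸n≡i∸[n∸j] i (m∸n≤m n j)) (cong (i ∸_) (m∸[m∸n]≡n j≤n))

  [i∸j]+i⊓j≡i : ∀ i j → (i ∸ j) + i ⊓ j ≡ i
  [i∸j]+i⊓j≡i i j = trans (+-comm (i ∸ j) (i ⊓ j)) (trans (cong (_+ (i ∸ j)) (⊓-comm i j)) (m⊓n+n∸m≡n j i))

  a*[c+k∸n]+[n∸k]*a≡a*c : ∀ a {c k n} → k ≤ n → n ≤ c + k → a * (c + k ∸ n) + (n ∸ k) * a ≡ a * c
  a*[c+k∸n]+[n∸k]*a≡a*c a {c} {k} k≤n n≤c+k with ≤-split k≤n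
  ... | e , refl with ≤-split (+-cancelˡ-≤ k e c (≤-trans n≤c+k (≤-reflexive (+-comm c k))))
  ...   | y , refl = begin
    a * (e + y + k ∸ (k + e)) + (k + e ∸ k) * a ≡⟨ cong₂ (λ u v → a * u + v * a) (∸-by (k + e) (shift e y k)) (m+n∸m≡n k e) ⟩
    a * y + e * a                               ≡⟨ collect a e y ⟩
    a * (e + y)                                 ∎
    where
    open ≡-Reasoning
    shift : ∀ e y k → e + y + k ≡ k + e + y
    shift = solve-∀
    collect : ∀ a e y → a * y + e * a ≡ a * (e + y)
    collect = solve-∀

  x*y<n*[x⊓y] : ∀ {n x y} → 0 < x → 0 < y → x < n → y < n → x * y < n * (x ⊓ y)
  x*y<n*[x⊓y] {n} {x} {y} 0<x 0<y x<n y<n with ≤-total x y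
  ... | inj₁ x≤y rewrite m≤n⇒m⊓n≡m x≤y = subst (_< n * x) (*-comm y x) (*-monoˡ-< x {{>-nonZero 0<x}} y<n)
  ... | inj₂ y≤x rewrite m≥n⇒m⊓n≡n y≤x = *-monoˡ-< y {{>-nonZero 0<y}} x<n

  n*[x+y∸n]+[n∸x]*[n∸y]≡x*y : ∀ {n x y} → x ≤ n → y ≤ n → n ≤ x + y → n * (x + y ∸ n) + (n ∸ x) * (n ∸ y) ≡ x * y
  n*[x+y∸n]+[n∸x]*[n∸y]≡x*y {n} {x} {y} x≤n y≤n n≤x+y with ≤-split x≤n
  ... | p , refl with ≤-split (+-cancelˡ-≤ x p y n≤x+y)
  ...   | r , refl with ≤-split (+-cancelʳ-≤ p r x (≤-trans (≤-reflexive (+-comm r p)) y≤n))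
  ...     | s , refl = begin
    n′ * (x′ + y′ ∸ n′) + (n′ ∸ x′) * (n′ ∸ y′) ≡⟨ cong₂ (λ u v → n′ * u + v) (∸-by n′ (excess r s p)) (cong₂ _*_ (m+n∸m≡n x′ p) (∸-by y′ (gap r s p))) ⟩
    n′ * r + p * s                              ≡⟨ expand r s p ⟩
    x′ * y′                                     ∎
    where
    open ≡-Reasoning
    x′ = r + s
    y′ = p + r
    n′ = r + s + p
    excess : ∀ r s p → r + s + (p + r) ≡ r + s + p + r
    excess = solve-∀
    gap : ∀ r s p → r + s + p ≡ p + r + s
    gap = solve-∀
    expand : ∀ r s p → (r + s + p) * r + p * s ≡ (r + s) * (p + r)
    expand = solve-∀

  n*[x+y∸n]<x*y : ∀ {n x y} → 0 < x → 0 < y → x < n → y < n → n * (x + y ∸ n) < x * y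
  n*[x+y∸n]<x*y {n} {x} {y} 0<x 0<y x<n y<n with x + y ≤? n
  ... | yes x+y≤n rewrite m≤n⇒m∸n≡0 x+y≤n | *-zeroʳ n = *-mono-< 0<x 0<y
  ... | no x+y≰n = begin-strict
    n * (x + y ∸ n)                             <⟨ m<m+n _ (*-mono-< (m<n⇒0<n∸m x<n) (m<n⇒0<n∸m y<n)) ⟩
    n * (x + y ∸ n) + (n ∸ x) * (n ∸ y)         ≡⟨ n*[x+y∸n]+[n∸x]*[n∸y]≡x*y (<⇒≤ x<n) (<⇒≤ y<n) (<⇒≤ (≰⇒> x+y≰n)) ⟩
    x * y                                       ∎
    where open ≤-Reasoning

  i⊓j+i⊔j≡i+j : ∀ i j → (i ⊓ j) + (i ⊔ j) ≡ i + j
  i⊓j+i⊔j≡i+j i j with ≤-total i j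
  ... | inj₁ i≤j rewrite m≤n⇒m⊓n≡m i≤j | m≤n⇒m⊔n≡n i≤j = refl
  ... | inj₂ j≤i rewrite m≥n⇒m⊓n≡n j≤i | m≥n⇒m⊔n≡m j≤i = +-comm j i

  i⊓j*i⊔j≡i*j : ∀ i j → (i ⊓ j) * (i ⊔ j) ≡ i * j
  i⊓j*i⊔j≡i*j i j with ≤-total i j
  ... | inj₁ i≤j rewrite m≤n⇒m⊓n≡m i≤j | m≤n⇒m⊔n≡n i≤j = refl
  ... | inj₂ j≤i rewrite m≥n⇒m⊓n≡n j≤i | m≥n⇒m⊔n≡m j≤i = *-comm j i

module MinimalEntries where

  open import Data.Nat
  open import Data.Nat.Properties
  open import Data.Nat.Tactic.RingSolver using (solve-∀)
  open import Data.Product using (Σ-syntax; _,_; _×_)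
  open import Data.Sum using (inj₁; inj₂)
  open import Relation.Nullary using (¬_; yes; no)
  open import Relation.Binary.PropositionalEquality
  open TruncatedSubtraction

  private
    variable
      a b i j k n : ℕ

  -- Truncated subtraction x ∸ n is used throughout as the positive part (x − n)⁺.
  cmin : ℕ → ℕ → ℕ → ℕ → ℕ
  cmin n i j k = i * (j + k ∸ n) ⊔ j * (i + k ∸ n) ⊔ k * (i + j ∸ n)

  cminSorted : ℕ → ℕ → ℕ → ℕ → ℕ
  cminSorted n a b k = k * (a + b ∸ n) ⊔ a * (b + k ∸ n)

  cmin-comm₁₂ : ∀ n i j k → cmin n i j k ≡ cmin n j i k
  cmin-comm₁₂ n i j k rewrite +-comm i j = cong (_⊔ k * (j + i ∸ n)) (⊔-comm (i * (j + k ∸ n)) (j * (i + k ∸ n)))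

  cmin-comm₂₃ : ∀ n i j k → cmin n i j k ≡ cmin n i k j
  cmin-comm₂₃ n i j k rewrite +-comm j k = begin
    x ⊔ y ⊔ z   ≡⟨ ⊔-assoc x y z ⟩
    x ⊔ (y ⊔ z) ≡⟨ cong (x ⊔_) (⊔-comm y z) ⟩
    x ⊔ (z ⊔ y) ≡⟨ ⊔-assoc x z y ⟨
    x ⊔ z ⊔ y   ∎
    where
    open ≡-Reasoning
    x = i * (k + j ∸ n)
    y = j * (i + k ∸ n)
    z = k * (i + j ∸ n)

  cmin-term-dominance : i ≤ j → j ≤ n → k ≤ n → j * (i + k ∸ n) ≤ i * (j + k ∸ n)
  cmin-term-dominance {i} {j} {n} {k} i≤j j≤n k≤n with i + k ≤? n
  ... | yes i+k≤n rewrite m≤n⇒m∸n≡0 i+k≤n | *-zeroʳ j = z≤n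
  ... | no i+k≰n with ≤-split i≤j | ≤-split k≤n
  ...   | d , refl | e , refl with ≤-split (≰⇒overshoot {i} {k} i+k≰n)
  ...     | a , refl = begin
    (e + a + d) * (e + a + k ∸ (k + e))     ≡⟨ cong ((e + a + d) *_) (∸-by (k + e) (shift₁ e a k)) ⟩
    (e + a + d) * a                         ≤⟨ exchange e a d ⟩
    (e + a) * (a + d)                       ≡⟨ cong ((e + a) *_) (∸-by (k + e) (shift₂ e a d k)) ⟨
    (e + a) * (e + a + d + k ∸ (k + e))     ∎
    where
    open ≤-Reasoning
    shift₁ : ∀ e a k → e + a + k ≡ k + e + a
    shift₁ = solve-∀
    shift₂ : ∀ e a d k → e + a + d + k ≡ k + e + (a + d)
    shift₂ = solve-∀

  cmin-sorted-≤ : i ≤ j → j ≤ n → k ≤ n → cmin n i j k ≡ cminSorted n i j k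
  cmin-sorted-≤ {i} {j} {n} {k} i≤j j≤n k≤n
    rewrite m≥n⇒m⊔n≡m (cmin-term-dominance i≤j j≤n k≤n) = ⊔-comm (i * (j + k ∸ n)) (k * (i + j ∸ n))

  cmin-sorted : i ≤ n → j ≤ n → k ≤ n → cmin n i j k ≡ cminSorted n (i ⊓ j) (i ⊔ j) k
  cmin-sorted {i} {n} {j} {k} i≤n j≤n k≤n with ≤-total i j
  ... | inj₁ i≤j rewrite m≤n⇒m⊓n≡m i≤j | m≤n⇒m⊔n≡n i≤j = cmin-sorted-≤ i≤j j≤n k≤n
  ... | inj₂ j≤i rewrite m≥n⇒m⊓n≡n j≤i | m≥n⇒m⊔n≡m j≤i =
    trans (cmin-comm₁₂ n i j k) (cmin-sorted-≤ j≤i i≤n k≤n)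

  cminSorted-≤a : ∀ a b k → b ≤ n → k ≤ a → cminSorted n a b k ≡ k * (a + b ∸ n)
  cminSorted-≤a {n} a b k b≤n k≤a = m≥n⇒m⊔n≡m second≤first
    where
    second≤first : a * (b + k ∸ n) ≤ k * (a + b ∸ n)
    second≤first with b + k ≤? n | ≤-split b≤n
    ... | yes b+k≤n | _ rewrite m≤n⇒m∸n≡0 b+k≤n | *-zeroʳ a = z≤n
    ... | no b+k≰n | e , refl with ≤-split (≰⇒overshoot {k} {b} (subst (λ x → ¬ x ≤ b + e) (+-comm b k) b+k≰n))
    ...   | y , refl with ≤-split k≤a
    ...     | z , refl = begin
      (e + y + z) * (b + (e + y) ∸ (b + e))   ≡⟨ cong ((e + y + z) *_) (∸-by (b + e) (sym (+-assoc b e y))) ⟩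
      (e + y + z) * y                         ≤⟨ exchange e y z ⟩
      (e + y) * (y + z)                       ≡⟨ cong ((e + y) *_) (∸-by (b + e) (shift b e y z)) ⟨
      (e + y) * (e + y + z + b ∸ (b + e))     ∎
      where
      open ≤-Reasoning
      shift : ∀ b e y z → e + y + z + b ≡ b + e + (y + z)
      shift = solve-∀

  cminSorted-≥a : ∀ a b k → b ≤ n → a ≤ k → cminSorted n a b k ≡ a * (b + k ∸ n)
  cminSorted-≥a {n} a b k b≤n a≤k = m≤n⇒m⊔n≡n first≤second
    where
    first≤second : k * (a + b ∸ n) ≤ a * (b + k ∸ n)
    first≤second with a + b ≤? n | ≤-split b≤n
    ... | yes a+b≤n | _ rewrite m≤n⇒m∸n≡0 a+b≤n | *-zeroʳ k = z≤n
    ... | no a+b≰n | e , refl with ≤-split (≰⇒overshoot {a} {b} a+b≰n)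
    ...   | l , refl with ≤-split a≤k
    ...     | z , refl = begin
      (e + l + z) * (e + l + b ∸ (b + e))       ≡⟨ cong ((e + l + z) *_) (∸-by (b + e) (shift₁ b e l)) ⟩
      (e + l + z) * l                           ≤⟨ exchange e l z ⟩
      (e + l) * (l + z)                         ≡⟨ cong ((e + l) *_) (∸-by (b + e) (shift₂ b e l z)) ⟨
      (e + l) * (b + (e + l + z) ∸ (b + e))     ∎
      where
      open ≤-Reasoning
      shift₁ : ∀ b e l → e + l + b ≡ b + e + l
      shift₁ = solve-∀
      shift₂ : ∀ b e l z → b + (e + l + z) ≡ b + e + (l + z)
      shift₂ = solve-∀

  cminSorted-low : ∀ a b k → a + b ≤ n → cminSorted n a b k ≡ a * (b + k ∸ n)
  cminSorted-low {n} a b k a+b≤n rewrite m≤n⇒m∸n≡0 a+b≤n | *-zeroʳ k = refl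

  cminSorted-start : b ≤ n → cminSorted n a b 0 ≡ 0
  cminSorted-start {b} {n} {a} b≤n = cminSorted-≤a a b 0 b≤n z≤n

  cminSorted-end : a ≤ n → b ≤ n → cminSorted n a b n ≡ a * b
  cminSorted-end {a} {n} {b} a≤n b≤n = trans (cminSorted-≥a a b n b≤n a≤n) (cong (a *_) (m+n∸n≡m b n))

  cminSorted-step-≤ : b ≤ n → cminSorted n a b (suc k) ≤ cminSorted n a b k + a
  cminSorted-step-≤ {b} {n} {a} {k} b≤n = ⊔-lub first second
    where
    open ≤-Reasoning
    first : suc k * (a + b ∸ n) ≤ cminSorted n a b k + a
    first = begin
      (a + b ∸ n) + k * (a + b ∸ n) ≡⟨ +-comm (a + b ∸ n) _ ⟩
      k * (a + b ∸ n) + (a + b ∸ n) ≤⟨ +-mono-≤ (m≤m⊔n _ _) (excess≤ a b≤n) ⟩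
      cminSorted n a b k + a        ∎
    second : a * (b + suc k ∸ n) ≤ cminSorted n a b k + a
    second = begin
      a * (b + suc k ∸ n)     ≡⟨ cong (λ x → a * (x ∸ n)) (+-suc b k) ⟩
      a * (suc (b + k) ∸ n)   ≤⟨ *-monoʳ-≤ a (suc-∸-≤ (b + k) n) ⟩
      a * suc (b + k ∸ n)     ≡⟨ *-suc a _ ⟩
      a + a * (b + k ∸ n)     ≡⟨ +-comm a _ ⟩
      a * (b + k ∸ n) + a     ≤⟨ +-monoˡ-≤ a (m≤n⊔m _ _) ⟩
      cminSorted n a b k + a  ∎

  cminSorted-step-≥ : b ≤ n → (a + b ∸ n) + cminSorted n a b k ≤ cminSorted n a b (suc k)
  cminSorted-step-≥ {b} {n} {a} {k} b≤n = begin
    l + cminSorted n a b k                     ≡⟨ +-distribˡ-⊔ l (k * l) _ ⟩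
    (l + k * l) ⊔ (l + a * (b + k ∸ n))        ≤⟨ ⊔-lub (m≤m⊔n _ _) second ⟩
    cminSorted n a b (suc k)                   ∎
    where
    open ≤-Reasoning
    l = a + b ∸ n
    second : l + a * (b + k ∸ n) ≤ cminSorted n a b (suc k)
    second with b + k ≤? n
    ... | yes b+k≤n rewrite m≤n⇒m∸n≡0 b+k≤n | *-zeroʳ a | +-identityʳ l = ≤-trans (m≤m+n l (k * l)) (m≤m⊔n _ _)
    ... | no b+k≰n = ≤-trans (+-monoˡ-≤ _ (excess≤ a b≤n)) (≤-trans (≤-reflexive grow) (m≤n⊔m _ _))
      where
      grow : a + a * (b + k ∸ n) ≡ a * (b + suc k ∸ n)
      grow = begin-equality
        a + a * (b + k ∸ n)   ≡⟨ *-suc a _ ⟨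
        a * suc (b + k ∸ n)   ≡⟨ cong (a *_) (+-∸-assoc 1 (<⇒≤ (≰⇒> b+k≰n))) ⟨
        a * (suc (b + k) ∸ n) ≡⟨ cong (λ x → a * (x ∸ n)) (+-suc b k) ⟨
        a * (b + suc k ∸ n)   ∎

  module _ {n i j} (i≤n : i ≤ n) (j≤n : j ≤ n) where

    private
      i⊔j≤n : i ⊔ j ≤ n
      i⊔j≤n = ⊔-lub i≤n j≤n

    cmin-start : cmin n i j 0 ≡ 0
    cmin-start = trans (cmin-sorted i≤n j≤n z≤n) (cminSorted-start {a = i ⊓ j} i⊔j≤n)

    cmin-end : cmin n i j n ≡ i * j
    cmin-end = begin
      cmin n i j n                         ≡⟨ cmin-sorted i≤n j≤n ≤-refl ⟩
      cminSorted n (i ⊓ j) (i ⊔ j) n       ≡⟨ cminSorted-end (≤-trans (m⊓n≤m i j) i≤n) i⊔j≤n ⟩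
      (i ⊓ j) * (i ⊔ j)                    ≡⟨ i⊓j*i⊔j≡i*j i j ⟩
      i * j                                ∎
      where open ≡-Reasoning

    cmin-step-≥ : ∀ {k} → k < n → (i + j ∸ n) + cmin n i j k ≤ cmin n i j (suc k)
    cmin-step-≥ {k} k<n rewrite cmin-sorted i≤n j≤n (<⇒≤ k<n) | cmin-sorted i≤n j≤n k<n | sym (i⊓j+i⊔j≡i+j i j) =
      cminSorted-step-≥ i⊔j≤n

    cmin-step-≤ : ∀ {k} → k < n → cmin n i j (suc k) ≤ cmin n i j k + i ⊓ j
    cmin-step-≤ {k} k<n rewrite cmin-sorted i≤n j≤n (<⇒≤ k<n) | cmin-sorted i≤n j≤n k<n =
      cminSorted-step-≤ i⊔j≤n

module Arrays where

  open import Data.Nat as ℕ using (ℕ; zero; suc; _≤_; _<_; s≤s; _⊓_)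
  import Data.Nat.Properties as ℕP
  open import Data.Integer as ℤ using (ℤ; +_; _-_; 0ℤ)
  import Data.Integer.Properties as ℤP
  open import Data.Fin using (Fin; toℕ; fromℕ; fromℕ<; inject₁) renaming (zero to fzero; suc to fsuc)
  import Data.Fin.Properties as FinP
  open import Data.Product using (Σ-syntax; _×_; _,_)
  open import Relation.Binary.PropositionalEquality
  open import Defs
  open Sums

  Array : Set
  Array = ℕ → ℕ → ℕ → ℤ

  OnCube : ℕ → (ℤ → ℤ → Set) → Array → Array → Set
  OnCube n R f g = ∀ i j k → i ≤ n → j ≤ n → k ≤ n → R (f i j k) (g i j k)

  _≤[_]_ : Array → ℕ → Array → Set
  f ≤[ n ] g = OnCube n ℤ._≤_ f g

  _≈[_]_ : Array → ℕ → Array → Set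
  f ≈[ n ] g = OnCube n _≡_ f g

  along₂ along₁ : Array → Array
  along₂ f i j k = f i k j
  along₁ f i j k = f k i j

  record IsCornerSum₃ (n : ℕ) (f : Array) : Set where
    field
      start : ∀ i j → i ≤ n → j ≤ n → f i j 0 ≡ 0ℤ
      end   : ∀ i j → i ≤ n → j ≤ n → f i j n ≡ + (i ℕ.* j)
      step  : ∀ i j k → i ≤ n → j ≤ n → k < n → InRange n i j (f i j (suc k) - f i j k)

  record IsCornerSumArray (n : ℕ) (f : Array) : Set where
    field
      axis₁ : IsCornerSum₃ n (along₁ f)
      axis₂ : IsCornerSum₃ n (along₂ f)
      axis₃ : IsCornerSum₃ n f

  IsCornerSum₃-cong : ∀ {n f g} → f ≈[ n ] g → IsCornerSum₃ n f → IsCornerSum₃ n g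
  IsCornerSum₃-cong {n} {f} {g} f≈g f₃ = record
    { start = λ i j i≤n j≤n → trans (sym (f≈g i j 0 i≤n j≤n ℕ.z≤n)) (start i j i≤n j≤n)
    ; end   = λ i j i≤n j≤n → trans (sym (f≈g i j n i≤n j≤n ℕP.≤-refl)) (end i j i≤n j≤n)
    ; step  = λ i j k i≤n j≤n k<n → subst (InRange n i j)
                (cong₂ _-_ (f≈g i j (suc k) i≤n j≤n k<n) (f≈g i j k i≤n j≤n (ℕP.<⇒≤ k<n)))
                (step i j k i≤n j≤n k<n)
    }
    where open IsCornerSum₃ f₃

  σ : ℕ → Array → ℤ
  σ n f = ∑[ i < suc n ] ∑[ j < suc n ] ∑[ k < suc n ] f i j k

  private
    <1+⇒≤ : ∀ {i n} → i < suc n → i ≤ n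
    <1+⇒≤ = ℕP.≤-pred

  σ-cong : ∀ {n f g} → f ≈[ n ] g → σ n f ≡ σ n g
  σ-cong f≈g = ∑-cong λ i i≤ → ∑-cong λ j j≤ → ∑-cong λ k k≤ → f≈g i j k (<1+⇒≤ i≤) (<1+⇒≤ j≤) (<1+⇒≤ k≤)

  private
    module _ {n f g} (f≤g : f ≤[ n ] g) where
      line-≤ : ∀ i j → i ≤ n → j ≤ n → ∑[ k < suc n ] f i j k ℤ.≤ ∑[ k < suc n ] g i j k
      line-≤ i j i≤n j≤n = ∑-mono-≤ λ k k≤ → f≤g i j k i≤n j≤n (<1+⇒≤ k≤)

      plane-≤ : ∀ i → i ≤ n → ∑[ j < suc n ] ∑[ k < suc n ] f i j k ℤ.≤ ∑[ j < suc n ] ∑[ k < suc n ] g i j k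
      plane-≤ i i≤n = ∑-mono-≤ λ j j≤ → line-≤ i j i≤n (<1+⇒≤ j≤)

  σ-mono-≤ : ∀ {n f g} → f ≤[ n ] g → σ n f ℤ.≤ σ n g
  σ-mono-≤ f≤g = ∑-mono-≤ λ i i≤ → plane-≤ f≤g i (<1+⇒≤ i≤)

  σ-≡⇒≈ : ∀ {n f g} → f ≤[ n ] g → σ n f ≡ σ n g → f ≈[ n ] g
  σ-≡⇒≈ f≤g eq i j k i≤n j≤n k≤n =
    ∑-≡⇒pointwise-≡ (λ k k≤ → f≤g i j k i≤n j≤n (<1+⇒≤ k≤))
      (∑-≡⇒pointwise-≡ (λ j j≤ → line-≤ f≤g i j i≤n (<1+⇒≤ j≤))
        (∑-≡⇒pointwise-≡ (λ i i≤ → plane-≤ f≤g i (<1+⇒≤ i≤)) eq i (s≤s i≤n))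
        j (s≤s j≤n))
      k (s≤s k≤n)

  σ-<⇒∃< : ∀ {n f g} → f ≤[ n ] g → σ n f ℤ.< σ n g →
           Σ[ i ∈ ℕ ] Σ[ j ∈ ℕ ] Σ[ k ∈ ℕ ] i ≤ n × j ≤ n × k ≤ n × f i j k ℤ.< g i j k
  σ-<⇒∃< f≤g lt with ∑-<⇒∃< (λ i i≤ → plane-≤ f≤g i (<1+⇒≤ i≤)) lt
  ... | i , i≤ , ltᵢ with ∑-<⇒∃< (λ j j≤ → line-≤ f≤g i j (<1+⇒≤ i≤) (<1+⇒≤ j≤)) ltᵢ
  ...   | j , j≤ , ltⱼ with ∑-<⇒∃< (λ k k≤ → f≤g i j k (<1+⇒≤ i≤) (<1+⇒≤ j≤) (<1+⇒≤ k≤)) ltⱼ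
  ...     | k , k≤ , ltₖ = i , j , k , <1+⇒≤ i≤ , <1+⇒≤ j≤ , <1+⇒≤ k≤ , ltₖ

  clamp : ∀ n → ℕ → Fin (suc n)
  clamp n i = fromℕ< (s≤s (ℕP.m⊓n≤n i n))

  toℕ-clamp : ∀ {n i} → i ≤ n → toℕ (clamp n i) ≡ i
  toℕ-clamp {n} {i} i≤n = trans (FinP.toℕ-fromℕ< (s≤s (ℕP.m⊓n≤n i n))) (ℕP.m≤n⇒m⊓n≡m i≤n)

  clamp-toℕ : ∀ {n} (x : Fin (suc n)) → clamp n (toℕ x) ≡ x
  clamp-toℕ x = FinP.toℕ-injective (toℕ-clamp (FinP.toℕ≤pred[n] x))

  toArray : ∀ {n} → HyperMatrix n → Array
  toArray {n} C i j k = C (clamp n i) (clamp n j) (clamp n k)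

  fromArray : ∀ {n} → Array → HyperMatrix n
  fromArray f x y z = f (toℕ x) (toℕ y) (toℕ z)

  toArray-fromArray : ∀ {n} f → toArray {n} (fromArray f) ≈[ n ] f
  toArray-fromArray f i j k i≤n j≤n k≤n rewrite toℕ-clamp i≤n | toℕ-clamp j≤n | toℕ-clamp k≤n = refl

  fromArray-toArray : ∀ {n} (C : HyperMatrix n) x y z → fromArray (toArray C) x y z ≡ C x y z
  fromArray-toArray C x y z rewrite clamp-toℕ x | clamp-toℕ y | clamp-toℕ z = refl

  private
    clamp-0 : ∀ {n} → clamp n 0 ≡ fzero
    clamp-0 {n} = FinP.toℕ-injective (toℕ-clamp {n} ℕ.z≤n)

    clamp-n : ∀ {n} → clamp n n ≡ fromℕ n
    clamp-n {n} = FinP.toℕ-injective (trans (toℕ-clamp ℕP.≤-refl) (sym (FinP.toℕ-fromℕ n)))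

    clamp-suc : ∀ {n k} (k<n : k < n) → clamp n (suc k) ≡ fsuc (fromℕ< k<n)
    clamp-suc k<n = FinP.toℕ-injective (trans (toℕ-clamp k<n) (cong suc (sym (FinP.toℕ-fromℕ< k<n))))

    clamp-inject₁ : ∀ {n k} (k<n : k < n) → clamp n k ≡ inject₁ (fromℕ< k<n)
    clamp-inject₁ k<n = FinP.toℕ-injective
      (trans (toℕ-clamp (ℕP.<⇒≤ k<n)) (sym (trans (FinP.toℕ-inject₁ (fromℕ< k<n)) (FinP.toℕ-fromℕ< k<n))))

  toArray-IsCornerSum₃ : ∀ {n} (C : HyperMatrix n) →
    (∀ i j → C i j fzero ≡ + 0) → (∀ i j → C i j (fromℕ n) ≡ + (toℕ i ℕ.* toℕ j)) →
    (∀ i j k → InRange n (toℕ i) (toℕ j) (C i j (fsuc k) - C i j (inject₁ k))) →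
    IsCornerSum₃ n (toArray C)
  toArray-IsCornerSum₃ {n} C bottom top step = record
    { start = λ i j _ _ → subst (λ z → C (clamp n i) (clamp n j) z ≡ 0ℤ) (sym clamp-0) (bottom _ _)
    ; end   = λ i j i≤n j≤n → trans (cong (C (clamp n i) (clamp n j)) clamp-n)
                                (trans (top _ _) (cong₂ (λ a b → + (a ℕ.* b)) (toℕ-clamp i≤n) (toℕ-clamp j≤n)))
    ; step  = step′
    }
    where
    step′ : ∀ i j k → i ≤ n → j ≤ n → k < n → InRange n i j (toArray C i j (suc k) - toArray C i j k)
    step′ i j k i≤n j≤n k<n rewrite clamp-suc k<n | clamp-inject₁ k<n =
      subst₂ (λ a b → InRange n a b (C x y (fsuc z) - C x y (inject₁ z))) (toℕ-clamp i≤n) (toℕ-clamp j≤n) (step x y z)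
      where
      x = clamp n i
      y = clamp n j
      z = fromℕ< k<n

  module _ {n f} (f₃ : IsCornerSum₃ n f) where
    open IsCornerSum₃ f₃

    fromArray-zero : ∀ i j → fromArray {n} f i j fzero ≡ + 0
    fromArray-zero i j = start _ _ (FinP.toℕ≤pred[n] i) (FinP.toℕ≤pred[n] j)

    fromArray-top : ∀ i j → fromArray {n} f i j (fromℕ n) ≡ + (toℕ i ℕ.* toℕ j)
    fromArray-top i j rewrite FinP.toℕ-fromℕ n = end _ _ (FinP.toℕ≤pred[n] i) (FinP.toℕ≤pred[n] j)

    fromArray-step : ∀ i j k → InRange n (toℕ i) (toℕ j) (fromArray {n} f i j (fsuc k) - fromArray f i j (inject₁ k))
    fromArray-step i j k rewrite FinP.toℕ-inject₁ k = step _ _ _ (FinP.toℕ≤pred[n] i) (FinP.toℕ≤pred[n] j) (FinP.toℕ<n k)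

  IsCornerSum⇒IsCornerSumArray : ∀ {n C} → IsCornerSum n C → IsCornerSumArray n (toArray C)
  IsCornerSum⇒IsCornerSumArray {C = C} cs = record
    { axis₁ = toArray-IsCornerSum₃ (λ i j k → C k i j) zero₁ top₁ step₁
    ; axis₂ = toArray-IsCornerSum₃ (λ i j k → C i k j) zero₂ top₂ step₂
    ; axis₃ = toArray-IsCornerSum₃ C zero₃ top₃ step₃
    }
    where open IsCornerSum cs

  IsCornerSumArray⇒IsCornerSum : ∀ {n f} → IsCornerSumArray n f → IsCornerSum n (fromArray f)
  IsCornerSumArray⇒IsCornerSum cs = record
    { zero₃ = fromArray-zero axis₃ ; zero₂ = fromArray-zero axis₂ ; zero₁ = fromArray-zero axis₁
    ; top₃  = fromArray-top axis₃  ; top₂  = fromArray-top axis₂  ; top₁  = fromArray-top axis₁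
    ; step₃ = fromArray-step axis₃ ; step₂ = fromArray-step axis₂ ; step₁ = fromArray-step axis₁
    }
    where open IsCornerSumArray cs

  σ-distrib-- : ∀ n f g → σ n f ℤ.- σ n g ≡ σ n (λ i j k → f i j k ℤ.- g i j k)
  σ-distrib-- n f g = sym (trans
    (∑-cong {suc n} λ i _ → trans (∑-cong {suc n} λ j _ → ∑-distrib-- (suc n) (f i j) (g i j)) (∑-distrib-- (suc n) _ _))
    (∑-distrib-- (suc n) _ _))

  toArray-mono : ∀ {n} {C D : HyperMatrix n} → C ≤ᴴ D → toArray C ≤[ n ] toArray D
  toArray-mono C≤D i j k _ _ _ = C≤D _ _ _

  fromArray-mono : ∀ {n f g} → f ≤[ n ] g → fromArray {n} f ≤ᴴ fromArray g
  fromArray-mono f≤g x y z = f≤g _ _ _ (FinP.toℕ≤pred[n] x) (FinP.toℕ≤pred[n] y) (FinP.toℕ≤pred[n] z)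

  fromArray-≤ᴴ : ∀ {n f} {C : HyperMatrix n} → f ≤[ n ] toArray C → fromArray f ≤ᴴ C
  fromArray-≤ᴴ {C = C} f≤C x y z = subst (_ ℤ.≤_) (fromArray-toArray C x y z) (fromArray-mono f≤C x y z)

  ≤ᴴ-fromArray : ∀ {n f} {C : HyperMatrix n} → toArray C ≤[ n ] f → C ≤ᴴ fromArray f
  ≤ᴴ-fromArray {C = C} C≤f x y z = subst (ℤ._≤ _) (fromArray-toArray C x y z) (fromArray-mono C≤f x y z)

  toArray-reflects-≤ : ∀ {n} {C D : HyperMatrix n} → toArray C ≤[ n ] toArray D → C ≤ᴴ D
  toArray-reflects-≤ {C = C} {D} C≤D x y z = subst₂ ℤ._≤_ (fromArray-toArray C x y z) (fromArray-toArray D x y z) (fromArray-mono C≤D x y z)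

module Extremes where

  open import Data.Nat as ℕ using (ℕ; zero; suc; _∸_; _⊓_; _⊔_; z≤n; s≤s)
  import Data.Nat.Properties as ℕP
  open import Data.Integer as ℤ using (ℤ; +_; -_; _-_; _+_; 0ℤ; _≤_)
  import Data.Integer.Properties as ℤP
  open import Data.Integer.Tactic.RingSolver using (solve-∀)
  open import Data.Product using (_,_; proj₁; proj₂)
  open import Data.Sum using (inj₁; inj₂)
  open import Relation.Nullary using (yes; no)
  open import Relation.Binary.PropositionalEquality
  open import Defs using (InRange)
  open TruncatedSubtraction
  open MinimalEntries
  open Arrays

  private
    pos-∸ : ∀ {m n} → n ℕ.≤ m → + (m ∸ n) ≡ + m - + n
    pos-∸ {m} {n} n≤m = trans (sym (ℤP.⊖-≥ n≤m)) (sym (ℤP.m-n≡m⊖n m n))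

    split-Δ : ∀ x y → y ≡ (y - x) + x
    split-Δ = solve-∀

    +-Δ-≤ : ∀ {a b x y} → a ≤ y - x → b ≤ x → a + b ≤ y
    +-Δ-≤ {x = x} {y} a≤Δ b≤x = ℤP.≤-trans (ℤP.+-mono-≤ a≤Δ b≤x) (ℤP.≤-reflexive (sym (split-Δ x y)))

    Δ-+-≤ : ∀ {a b x y} → y - x ≤ a → x ≤ b → y ≤ a + b
    Δ-+-≤ {x = x} {y} Δ≤a x≤b = ℤP.≤-trans (ℤP.≤-reflexive (split-Δ x y)) (ℤP.+-mono-≤ Δ≤a x≤b)

    -‿monoʳ-≤ : ∀ a {b c} → b ≤ c → a - c ≤ a - b
    -‿monoʳ-≤ a b≤c = ℤP.+-monoʳ-≤ a (ℤP.neg-mono-≤ b≤c)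

    ∸-split : ∀ {x y m} → x ℕ.+ y ≡ m → + m - + x ≡ + y
    ∸-split {x} {y} refl = cancel (+ x) (+ y)
      where
      cancel : ∀ x y → x + y - x ≡ y
      cancel = solve-∀

  InRange-∸ : ∀ {n i j x y} → (i ℕ.+ j ∸ n) ℕ.+ x ℕ.≤ y → y ℕ.≤ x ℕ.+ i ⊓ j → InRange n i j (+ y - + x)
  InRange-∸ {n} {i} {j} {x} {y} lo hi = subst (InRange n i j) (pos-∸ x≤y)
    (ℤ.+≤+ (ℕP.m+n≤o⇒m≤o∸n _ lo) , ℤ.+≤+ (ℕP.m≤n+o⇒m∸n≤o y x hi))
    where
    x≤y = ℕP.≤-trans (ℕP.m≤n+m x _) lo

  Cmin : ℕ → Array
  Cmin n i j k = + cmin n i j k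

  Cmin-IsCornerSum₃ : ∀ n → IsCornerSum₃ n (Cmin n)
  Cmin-IsCornerSum₃ n = record
    { start = λ i j i≤n j≤n → cong +_ (cmin-start i≤n j≤n)
    ; end   = λ i j i≤n j≤n → cong +_ (cmin-end i≤n j≤n)
    ; step  = λ i j k i≤n j≤n k<n → InRange-∸ {n} (cmin-step-≥ i≤n j≤n k<n) (cmin-step-≤ i≤n j≤n k<n)
    }

  Cmin-IsCornerSumArray : ∀ n → IsCornerSumArray n (Cmin n)
  Cmin-IsCornerSumArray n = record
    { axis₁ = IsCornerSum₃-cong (λ i j k _ _ _ → cong +_ (trans (cmin-comm₂₃ n i j k) (cmin-comm₁₂ n i k j)))
                (Cmin-IsCornerSum₃ n)
    ; axis₂ = IsCornerSum₃-cong (λ i j k _ _ _ → cong +_ (cmin-comm₂₃ n i j k)) (Cmin-IsCornerSum₃ n)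
    ; axis₃ = Cmin-IsCornerSum₃ n
    }

  flip-InRange : ∀ {n i j d} → j ℕ.≤ n → InRange n i (n ∸ j) d → InRange n i j (+ i - d)
  flip-InRange {n} {i} {j} {d} j≤n (lo , hi) =
    subst (_≤ + i - d) (∸-split (i⊓[n∸j]+[i+j∸n]≡i i j≤n)) (-‿monoʳ-≤ (+ i) hi) ,
    subst (+ i - d ≤_) (∸-split ([i∸j]+i⊓j≡i i j)) (-‿monoʳ-≤ (+ i) (subst (λ x → + x ≤ d) (i+[n∸j]∸n≡i∸j i j≤n) lo))

  dual₃ : ℕ → Array → Array
  dual₃ n f i j k = + (i ℕ.* j) - f i j (n ∸ k)

  dual₂ : ℕ → Array → Array
  dual₂ n f i j k = + (i ℕ.* k) - f i (n ∸ j) k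

  private
    n∸k-suc : ∀ {n k} → k ℕ.< n → suc (n ∸ suc k) ≡ n ∸ k
    n∸k-suc k<n = sym (ℕP.+-∸-assoc 1 k<n)

    n∸k<n : ∀ {n k} → k ℕ.< n → n ∸ suc k ℕ.< n
    n∸k<n {n} {k} k<n = subst (ℕ._≤ n) (sym (n∸k-suc k<n)) (ℕP.m∸n≤m n k)

  dual₃-IsCornerSum₃ : ∀ {n f} → IsCornerSum₃ n f → IsCornerSum₃ n (dual₃ n f)
  dual₃-IsCornerSum₃ {n} {f} f₃ = record
    { start = λ i j i≤n j≤n → trans (cong (λ x → + (i ℕ.* j) - x) (end i j i≤n j≤n)) (ℤP.+-inverseʳ (+ (i ℕ.* j)))
    ; end   = λ i j i≤n j≤n → trans (cong (λ k → + (i ℕ.* j) - f i j k) (ℕP.n∸n≡0 n))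
                                (trans (cong (λ x → + (i ℕ.* j) - x) (start i j i≤n j≤n)) (ℤP.+-identityʳ _))
    ; step  = λ i j k i≤n j≤n k<n → subst (InRange n i j)
                (trans (cong (λ k′ → f i j k′ - f i j (n ∸ suc k)) (n∸k-suc k<n)) (sym (cancel (+ (i ℕ.* j)) (f i j (n ∸ suc k)) (f i j (n ∸ k)))))
                (step i j (n ∸ suc k) i≤n j≤n (n∸k<n k<n))
    }
    where
    open IsCornerSum₃ f₃
    cancel : ∀ c x y → (c - x) - (c - y) ≡ y - x
    cancel = solve-∀

  dual₂-IsCornerSum₃ : ∀ {n f} → IsCornerSum₃ n f → IsCornerSum₃ n (dual₂ n f)
  dual₂-IsCornerSum₃ {n} {f} f₃ = record
    { start = λ i j i≤n j≤n → cong₂ (λ a b → + a - b) (ℕP.*-zeroʳ i) (start i (n ∸ j) i≤n (ℕP.m∸n≤m n j))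
    ; end   = λ i j i≤n j≤n → trans (cong (λ x → + (i ℕ.* n) - x) (end i (n ∸ j) i≤n (ℕP.m∸n≤m n j)))
                                (∸-split (trans (sym (ℕP.*-distribˡ-+ i (n ∸ j) j)) (cong (i ℕ.*_) (ℕP.m∸n+n≡m j≤n))))
    ; step  = λ i j k i≤n j≤n k<n → subst (InRange n i j)
                (sym (trans (cong (λ x → + x - f i (n ∸ j) (suc k) - (+ (i ℕ.* k) - f i (n ∸ j) k)) (ℕP.*-suc i k)) (regroup (+ i) (+ (i ℕ.* k)) (f i (n ∸ j) k) (f i (n ∸ j) (suc k)))))
                (flip-InRange j≤n (step i (n ∸ j) k i≤n (ℕP.m∸n≤m n j) k<n))
    }
    where
    open IsCornerSum₃ f₃
    regroup : ∀ a b x y → (a + b - y) - (b - x) ≡ a - (y - x)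
    regroup = solve-∀

  dual₃-IsCornerSumArray : ∀ {n f} → IsCornerSumArray n f → IsCornerSumArray n (dual₃ n f)
  dual₃-IsCornerSumArray {n} {f} cs = record
    { axis₁ = IsCornerSum₃-cong (λ i j k _ _ _ → cong (λ x → + x - f k i (n ∸ j)) (ℕP.*-comm i k)) (dual₂-IsCornerSum₃ axis₁)
    ; axis₂ = dual₂-IsCornerSum₃ axis₂
    ; axis₃ = dual₃-IsCornerSum₃ axis₃
    }
    where open IsCornerSumArray cs

  Cmax : ℕ → Array
  Cmax n = dual₃ n (Cmin n)

  Cmax-IsCornerSumArray : ∀ n → IsCornerSumArray n (Cmax n)
  Cmax-IsCornerSumArray n = dual₃-IsCornerSumArray (Cmin-IsCornerSumArray n)

  module _ {n f} (f₃ : IsCornerSum₃ n f) {i j} (i≤n : i ℕ.≤ n) (j≤n : j ℕ.≤ n) where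
    open IsCornerSum₃ f₃

    growth-≥ : ∀ k → k ℕ.≤ n → + (k ℕ.* (i ℕ.+ j ∸ n)) ≤ f i j k
    growth-≥ zero    _   = ℤP.≤-reflexive (sym (start i j i≤n j≤n))
    growth-≥ (suc k) k<n = +-Δ-≤ (proj₁ (step i j k i≤n j≤n k<n)) (growth-≥ k (ℕP.<⇒≤ k<n))

    growth-≤ : ∀ k → k ℕ.≤ n → f i j k ≤ + (k ℕ.* (i ⊓ j))
    growth-≤ zero    _   = ℤP.≤-reflexive (start i j i≤n j≤n)
    growth-≤ (suc k) k<n = Δ-+-≤ (proj₂ (step i j k i≤n j≤n k<n)) (growth-≤ k (ℕP.<⇒≤ k<n))

  private
    pos-⊔-≤ : ∀ {a b z} → + a ≤ z → + b ≤ z → + (a ⊔ b) ≤ z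
    pos-⊔-≤ {a} {b} a≤z b≤z with ℕP.⊔-sel a b
    ... | inj₁ eq rewrite eq = a≤z
    ... | inj₂ eq rewrite eq = b≤z

  Cmin-≤ : ∀ {n f} → IsCornerSum₃ n f → Cmin n ≤[ n ] f
  Cmin-≤ {n} {f} f₃ i j k i≤n j≤n k≤n =
    pos-⊔-≤ (pos-⊔-≤ (term i j (ℕP.m⊓n≤m i j) refl) (term j i (ℕP.m⊓n≤n i j) (ℕP.*-comm j i))) (growth-≥ f₃ i≤n j≤n k k≤n)
    where
    open ℤP.≤-Reasoning
    term : ∀ a c → i ⊓ j ℕ.≤ a → a ℕ.* c ≡ i ℕ.* j → + (a ℕ.* (c ℕ.+ k ∸ n)) ≤ f i j k
    term a c i⊓j≤a ac≡ij with c ℕ.+ k ℕ.≤? n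
    ... | yes c+k≤n rewrite ℕP.m≤n⇒m∸n≡0 c+k≤n | ℕP.*-zeroʳ a = ℤP.≤-trans (ℤ.+≤+ z≤n) (growth-≥ f₃ i≤n j≤n k k≤n)
    ... | no c+k≰n = begin
      + (a ℕ.* (c ℕ.+ k ∸ n))                    ≡⟨ ∸-split (trans (ℕP.+-comm ((n ∸ k) ℕ.* a) _) (trans (a*[c+k∸n]+[n∸k]*a≡a*c a k≤n (ℕP.<⇒≤ (ℕP.≰⇒> c+k≰n))) ac≡ij)) ⟨
      + (i ℕ.* j) - + ((n ∸ k) ℕ.* a)            ≤⟨ -‿monoʳ-≤ (+ (i ℕ.* j)) (ℤ.+≤+ (ℕP.*-monoʳ-≤ (n ∸ k) i⊓j≤a)) ⟩
      + (i ℕ.* j) - + ((n ∸ k) ℕ.* (i ⊓ j))      ≤⟨ -‿monoʳ-≤ (+ (i ℕ.* j)) (growth-≤ (dual₃-IsCornerSum₃ f₃) i≤n j≤n (n ∸ k) (ℕP.m∸n≤m n k)) ⟩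
      + (i ℕ.* j) - dual₃ n f i j (n ∸ k)         ≡⟨ cong (λ x → + (i ℕ.* j) - (+ (i ℕ.* j) - f i j x)) (ℕP.m∸[m∸n]≡n k≤n) ⟩
      + (i ℕ.* j) - (+ (i ℕ.* j) - f i j k)       ≡⟨ cancel (+ (i ℕ.* j)) (f i j k) ⟩
      f i j k                                     ∎
      where
      cancel : ∀ c x → c - (c - x) ≡ x
      cancel = solve-∀

  ≤-Cmax : ∀ {n f} → IsCornerSum₃ n f → f ≤[ n ] Cmax n
  ≤-Cmax {n} {f} f₃ i j k i≤n j≤n k≤n = begin
    f i j k                                              ≡⟨ swap (+ (i ℕ.* j)) (f i j k) ⟩
    + (i ℕ.* j) - (+ (i ℕ.* j) - f i j k)                ≡⟨ cong (λ x → + (i ℕ.* j) - (+ (i ℕ.* j) - f i j x)) (ℕP.m∸[m∸n]≡n k≤n) ⟨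
    + (i ℕ.* j) - dual₃ n f i j (n ∸ k)                  ≤⟨ -‿monoʳ-≤ (+ (i ℕ.* j)) (Cmin-≤ (dual₃-IsCornerSum₃ f₃) i j (n ∸ k) i≤n j≤n (ℕP.m∸n≤m n k)) ⟩
    Cmax n i j k                                         ∎
    where
    open ℤP.≤-Reasoning
    swap : ∀ c x → x ≡ c - (c - x)
    swap = solve-∀

module Covering where

  open import Data.Nat as ℕ using (ℕ; zero; suc; _∸_; _⊓_; z≤n; s≤s)
  import Data.Nat.Properties as ℕP
  open import Data.Integer as ℤ using (ℤ; +_; -_; _-_; _+_; _*_; 0ℤ; 1ℤ; -1ℤ; _≤_; _<_)
  import Data.Integer.Properties as ℤP
  open import Data.Integer.Tactic.RingSolver using (solve-∀)
  open import Data.Empty using (⊥-elim)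
  open import Data.Product using (Σ-syntax; _×_; _,_; proj₁; proj₂)
  open import Data.Sum using (_⊎_; inj₁; inj₂; [_,_]′)
  open import Relation.Nullary using (yes; no)
  open import Data.List using (List; upTo; cartesianProduct)
  open import Data.List.Membership.Propositional using (_∈_)
  open import Data.List.Membership.Propositional.Properties using (∈-upTo⁺; ∈-upTo⁻; ∈-cartesianProduct⁺; ∈-cartesianProduct⁻)
  open import Data.List.Relation.Unary.All using (lookup)
  open import Data.Product.Relation.Binary.Lex.NonStrict using (×-totalOrder)
  open import Relation.Binary.Bundles using (TotalOrder)
  open import Level using (0ℓ)
  open import Relation.Binary.PropositionalEquality
  open import Defs using (InRange)
  open Sums
  open TruncatedSubtraction
  open Arrays

  δ : ℕ → ℕ → ℤ
  δ a i with i ℕ.≟ a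
  ... | yes _ = 1ℤ
  ... | no  _ = 0ℤ

  δ-refl : ∀ a → δ a a ≡ 1ℤ
  δ-refl a with a ℕ.≟ a
  ... | yes _   = refl
  ... | no  a≢a = ⊥-elim (a≢a refl)

  δ-≢ : ∀ {a i} → i ≢ a → δ a i ≡ 0ℤ
  δ-≢ {a} {i} i≢a with i ℕ.≟ a
  ... | yes i≡a = ⊥-elim (i≢a i≡a)
  ... | no  _   = refl

  δ-cases : ∀ a i → δ a i ≡ 0ℤ ⊎ (i ≡ a × δ a i ≡ 1ℤ)
  δ-cases a i with i ℕ.≟ a
  ... | yes i≡a = inj₂ (i≡a , refl)
  ... | no  _   = inj₁ refl

  ∑-δ-≤ : ∀ {a m} → m ℕ.≤ a → ∑ m (δ a) ≡ 0ℤ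
  ∑-δ-≤ {a} {zero}  _     = refl
  ∑-δ-≤ {a} {suc m} m<a = cong₂ _+_ (∑-δ-≤ (ℕP.<⇒≤ m<a)) (δ-≢ (ℕP.<⇒≢ m<a))

  ∑-δ : ∀ {a m} → a ℕ.< m → ∑ m (δ a) ≡ 1ℤ
  ∑-δ {a} {suc m} a<1+m with ℕP.m<1+n⇒m<n∨m≡n a<1+m
  ... | inj₁ a<m  = cong₂ _+_ (∑-δ a<m) (δ-≢ (ℕP.>⇒≢ a<m))
  ... | inj₂ refl = cong₂ _+_ (∑-δ-≤ {a} ℕP.≤-refl) (δ-refl a)

  InRange-bump : ∀ {n i j x₀ x₁ k c} X → InRange n i j (x₁ - x₀) →
    X ≡ 0ℤ ⊎ (X ≡ 1ℤ × (suc k ≡ c → x₁ - x₀ < + (i ⊓ j)) × (k ≡ c → + (i ℕ.+ j ∸ n) < x₁ - x₀)) →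
    InRange n i j ((x₁ + X * δ c (suc k)) - (x₀ + X * δ c k))
  InRange-bump {n} {i} {j} {x₀} {x₁} {k} {c} X range (inj₁ refl) =
    subst (InRange n i j) (unchanged x₀ x₁ (δ c (suc k)) (δ c k)) range
    where
    unchanged : ∀ x₀ x₁ u v → x₁ - x₀ ≡ (x₁ + 0ℤ * u) - (x₀ + 0ℤ * v)
    unchanged = solve-∀
  InRange-bump {n} {i} {j} {x₀} {x₁} {k} {c} X (lo , hi) (inj₂ (refl , upper , lower))
    with suc k ℕ.≟ c | k ℕ.≟ c
  ... | yes refl | yes k≡1+k = ⊥-elim (ℕP.1+n≢n (sym k≡1+k))
  ... | yes 1+k≡c | no _ = subst (InRange n i j) (raised x₀ x₁)
    (ℤP.≤-trans lo (ℤP.i≤suc[i] _) , ℤP.i<j⇒suc[i]≤j (upper 1+k≡c))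
    where
    raised : ∀ x₀ x₁ → 1ℤ + (x₁ - x₀) ≡ (x₁ + 1ℤ * 1ℤ) - (x₀ + 1ℤ * 0ℤ)
    raised = solve-∀
  ... | no _ | yes k≡c = subst (InRange n i j) (lowered x₀ x₁)
    (ℤP.i<j⇒i≤pred[j] (lower k≡c) , ℤP.i≤j⇒pred[i]≤j hi)
    where
    lowered : ∀ x₀ x₁ → -1ℤ + (x₁ - x₀) ≡ (x₁ + 1ℤ * 0ℤ) - (x₀ + 1ℤ * 1ℤ)
    lowered = solve-∀
  ... | no _ | no _ = subst (InRange n i j) (unchanged x₀ x₁) (lo , hi)
    where
    unchanged : ∀ x₀ x₁ → x₁ - x₀ ≡ (x₁ + 1ℤ * 0ℤ) - (x₀ + 1ℤ * 0ℤ)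
    unchanged = solve-∀

  blocked-upper : ∀ N A {h} {x y : ℕ → ℤ} k → x (suc k) - x k ≤ h → y (suc k) - y k ≤ h →
                  y k - x k ≤ y (suc k) - x (suc k) →
                  (y k - x k ≡ y (suc k) - x (suc k) → N * x (suc k) - A * + suc k ≤ N * x k - A * + k) →
                  A < N * h → x (suc k) - x k < h
  blocked-upper N A {h} {x} {y} k Δx≤h Δy≤h gap₀≤gap₁ φ₁≤φ₀ A<Nh with x (suc k) - x k ℤP.<? h
  ... | yes Δx<h = Δx<h
  ... | no  Δx≮h = ⊥-elim (ℤP.<⇒≱ A<Nh Nh≤A)
    where
    open ℤP.≤-Reasoning
    x₀ = x k
    x₁ = x (suc k)
    y₀ = y k
    y₁ = y (suc k)
    Δx≡h : x₁ - x₀ ≡ h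
    Δx≡h = ℤP.≤-antisym Δx≤h (ℤP.≮⇒≥ Δx≮h)
    gap₁≤gap₀ : y₁ - x₁ ≤ y₀ - x₀
    gap₁≤gap₀ = begin
      y₁ - x₁                             ≡⟨ regroup x₀ x₁ y₀ y₁ ⟩
      (y₁ - y₀) - (x₁ - x₀) + (y₀ - x₀)   ≤⟨ ℤP.+-monoˡ-≤ (y₀ - x₀) (ℤP.+-monoˡ-≤ (- (x₁ - x₀)) Δy≤h) ⟩
      h - (x₁ - x₀) + (y₀ - x₀)           ≡⟨ cong (λ d → h - d + (y₀ - x₀)) Δx≡h ⟩
      h - h + (y₀ - x₀)                   ≡⟨ cancel h (y₀ - x₀) ⟩
      y₀ - x₀                             ∎
      where
      regroup : ∀ x₀ x₁ y₀ y₁ → y₁ - x₁ ≡ (y₁ - y₀) - (x₁ - x₀) + (y₀ - x₀)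
      regroup = solve-∀
      cancel : ∀ h d → h - h + d ≡ d
      cancel = solve-∀
    Nh≤A : N * h ≤ A
    Nh≤A = begin
      N * h                                                       ≡⟨ cong (N *_) Δx≡h ⟨
      N * (x₁ - x₀)                                               ≡⟨ regroup N A (+ k) x₀ x₁ ⟩
      ((N * x₁ - A * + suc k) - (N * x₀ - A * + k)) + A           ≤⟨ ℤP.+-monoˡ-≤ A (ℤP.i≤j⇒i-j≤0 (φ₁≤φ₀ (ℤP.≤-antisym gap₀≤gap₁ gap₁≤gap₀))) ⟩
      0ℤ + A                                                      ≡⟨ ℤP.+-identityˡ A ⟩
      A                                                           ∎
      where
      regroup : ∀ N A K x₀ x₁ → N * (x₁ - x₀) ≡ ((N * x₁ - A * (1ℤ + K)) - (N * x₀ - A * K)) + A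
      regroup = solve-∀

  blocked-lower : ∀ N A {l} {x y : ℕ → ℤ} k → l ≤ x (suc k) - x k → l ≤ y (suc k) - y k →
                  y (suc k) - x (suc k) ≤ y k - x k →
                  (y (suc k) - x (suc k) ≡ y k - x k → N * x k - A * + k ≤ N * x (suc k) - A * + suc k) →
                  N * l < A → l < x (suc k) - x k
  blocked-lower N A {l} {x} {y} k l≤Δx l≤Δy gap₁≤gap₀ φ₀≤φ₁ Nl<A with l ℤP.<? x (suc k) - x k
  ... | yes l<Δx = l<Δx
  ... | no  l≮Δx = ⊥-elim (ℤP.<⇒≱ Nl<A A≤Nl)
    where
    open ℤP.≤-Reasoning
    x₀ = x k
    x₁ = x (suc k)
    y₀ = y k
    y₁ = y (suc k)
    Δx≡l : x₁ - x₀ ≡ l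
    Δx≡l = ℤP.≤-antisym (ℤP.≮⇒≥ l≮Δx) l≤Δx
    gap₀≤gap₁ : y₀ - x₀ ≤ y₁ - x₁
    gap₀≤gap₁ = begin
      y₀ - x₀                             ≡⟨ cancel l (y₀ - x₀) ⟨
      l - l + (y₀ - x₀)                   ≡⟨ cong (λ d → l - d + (y₀ - x₀)) Δx≡l ⟨
      l - (x₁ - x₀) + (y₀ - x₀)           ≤⟨ ℤP.+-monoˡ-≤ (y₀ - x₀) (ℤP.+-monoˡ-≤ (- (x₁ - x₀)) l≤Δy) ⟩
      (y₁ - y₀) - (x₁ - x₀) + (y₀ - x₀)   ≡⟨ regroup x₀ x₁ y₀ y₁ ⟨
      y₁ - x₁                             ∎
      where
      regroup : ∀ x₀ x₁ y₀ y₁ → y₁ - x₁ ≡ (y₁ - y₀) - (x₁ - x₀) + (y₀ - x₀)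
      regroup = solve-∀
      cancel : ∀ h d → h - h + d ≡ d
      cancel = solve-∀
    A≤Nl : A ≤ N * l
    A≤Nl = begin
      A                                                           ≡⟨ ℤP.+-identityʳ A ⟨
      A + 0ℤ                                                      ≤⟨ ℤP.+-monoʳ-≤ A (ℤP.i≤j⇒0≤j-i (φ₀≤φ₁ (ℤP.≤-antisym gap₁≤gap₀ gap₀≤gap₁))) ⟩
      A + ((N * x₁ - A * + suc k) - (N * x₀ - A * + k))           ≡⟨ regroup N A (+ k) x₀ x₁ ⟩
      N * (x₁ - x₀)                                               ≡⟨ cong (N *_) Δx≡l ⟩
      N * l                                                       ∎
      where
      regroup : ∀ N A K x₀ x₁ → A + ((N * x₁ - A * (1ℤ + K)) - (N * x₀ - A * K)) ≡ N * (x₁ - x₀)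
      regroup = solve-∀

  gap : Array → Array → Array
  gap f g i j k = g i j k - f i j k

  φ : ℕ → Array → Array
  φ n f i j k = + n * f i j k - + i * + j * + k

  bump : ℕ → ℕ → ℕ → Array → Array
  bump a b c f i j k = f i j k + δ a i * δ b j * δ c k

  private
    δ-product-cases : ∀ a b i j → δ a i * δ b j ≡ 0ℤ ⊎ (δ a i * δ b j ≡ 1ℤ × i ≡ a × j ≡ b)
    δ-product-cases a b i j with δ-cases a i | δ-cases b j
    ... | inj₁ δ≡0 | _ rewrite δ≡0 = inj₁ refl
    ... | inj₂ _ | inj₁ δ≡0 rewrite δ≡0 = inj₁ (ℤP.*-zeroʳ (δ a i))
    ... | inj₂ (i≡a , δ≡1) | inj₂ (j≡b , δ′≡1) rewrite δ≡1 | δ′≡1 = inj₂ (refl , i≡a , j≡b)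

  module _ {n f g a b c} (f₃ : IsCornerSum₃ n f) (g₃ : IsCornerSum₃ n g)
           (0<a : 0 ℕ.< a) (a<n : a ℕ.< n) (0<b : 0 ℕ.< b) (b<n : b ℕ.< n) (0<c : 0 ℕ.< c) (c<n : c ℕ.< n)
           (gap-max : ∀ k → k ℕ.≤ n → gap f g a b k ≤ gap f g a b c)
           (φ-min : ∀ k → k ℕ.≤ n → gap f g a b k ≡ gap f g a b c → φ n f a b c ≤ φ n f a b k) where

    private
      module F = IsCornerSum₃ f₃
      module G = IsCornerSum₃ g₃
      a≤n = ℕP.<⇒≤ a<n
      b≤n = ℕP.<⇒≤ b<n

      slack-below : ∀ k → suc k ≡ c → f a b (suc k) - f a b k < + (a ⊓ b)
      slack-below k refl = blocked-upper (+ n) (+ a * + b) {x = f a b} {g a b} k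
        (proj₂ (F.step a b k a≤n b≤n k<n)) (proj₂ (G.step a b k a≤n b≤n k<n))
        (gap-max k k≤n) (φ-min k k≤n)
        (subst₂ _<_ (ℤP.pos-* a b) (ℤP.pos-* n (a ⊓ b)) (ℤ.+<+ (x*y<n*[x⊓y] 0<a 0<b a<n b<n)))
        where
        k<n = ℕP.<⇒≤ c<n
        k≤n = ℕP.<⇒≤ k<n

      slack-above : ∀ k → k ≡ c → + (a ℕ.+ b ∸ n) < f a b (suc k) - f a b k
      slack-above k refl = blocked-lower (+ n) (+ a * + b) {x = f a b} {g a b} k
        (proj₁ (F.step a b k a≤n b≤n c<n)) (proj₁ (G.step a b k a≤n b≤n c<n))
        (gap-max (suc k) c<n) (φ-min (suc k) c<n)
        (subst₂ _<_ (ℤP.pos-* n (a ℕ.+ b ∸ n)) (ℤP.pos-* a b) (ℤ.+<+ (n*[x+y∸n]<x*y 0<a 0<b a<n b<n)))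

    bump-IsCornerSum₃ : IsCornerSum₃ n (bump a b c f)
    bump-IsCornerSum₃ = record
      { start = λ i j i≤n j≤n → trans (cong₂ (λ u v → u + δ a i * δ b j * v) (F.start i j i≤n j≤n) (δ-≢ (ℕP.<⇒≢ 0<c)))
                                  (vanish (δ a i * δ b j))
      ; end   = λ i j i≤n j≤n → trans (cong₂ (λ u v → u + δ a i * δ b j * v) (F.end i j i≤n j≤n) (δ-≢ (ℕP.>⇒≢ c<n)))
                                  (unchanged (+ (i ℕ.* j)) (δ a i * δ b j))
      ; step  = λ i j k i≤n j≤n k<n → InRange-bump {n} {x₀ = f i j k} {f i j (suc k)} (δ a i * δ b j) (F.step i j k i≤n j≤n k<n) (slack i j k)
      }
      where
      vanish : ∀ X → 0ℤ + X * 0ℤ ≡ 0ℤ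
      vanish = solve-∀
      unchanged : ∀ x X → x + X * 0ℤ ≡ x
      unchanged = solve-∀
      slack : ∀ i j k → δ a i * δ b j ≡ 0ℤ ⊎ (δ a i * δ b j ≡ 1ℤ
              × (suc k ≡ c → f i j (suc k) - f i j k < + (i ⊓ j)) × (k ≡ c → + (i ℕ.+ j ∸ n) < f i j (suc k) - f i j k))
      slack i j k with δ-product-cases a b i j
      ... | inj₁ X≡0 = inj₁ X≡0
      ... | inj₂ (X≡1 , refl , refl) = inj₂ (X≡1 , slack-below k , slack-above k)

  strict⇒interior : ∀ {n f g a b c} → IsCornerSum₃ n f → IsCornerSum₃ n g → a ℕ.≤ n → b ℕ.≤ n → c ℕ.≤ n →
                    f a b c < g a b c → 0 ℕ.< c × c ℕ.< n
  strict⇒interior {c = zero} f₃ g₃ a≤n b≤n _ f<g =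
    ⊥-elim (ℤP.<-irrefl (trans (IsCornerSum₃.start f₃ _ _ a≤n b≤n) (sym (IsCornerSum₃.start g₃ _ _ a≤n b≤n))) f<g)
  strict⇒interior {n} {c = suc c} f₃ g₃ a≤n b≤n c≤n f<g = s≤s z≤n , ℕP.≤∧≢⇒< c≤n at-top
    where
    at-top : suc c ≢ n
    at-top refl = ℤP.<-irrefl (trans (IsCornerSum₃.end f₃ _ _ a≤n b≤n) (sym (IsCornerSum₃.end g₃ _ _ a≤n b≤n))) f<g

  Point : Set
  Point = ℕ × ℕ × ℕ

  InCube : ℕ → Point → Set
  InCube n (i , j , k) = i ℕ.≤ n × j ℕ.≤ n × k ℕ.≤ n

  cube : ℕ → List Point
  cube n = cartesianProduct (upTo (suc n)) (cartesianProduct (upTo (suc n)) (upTo (suc n)))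

  ∈-cube⁺ : ∀ {n} p → InCube n p → p ∈ cube n
  ∈-cube⁺ _ (i≤n , j≤n , k≤n) = ∈-cartesianProduct⁺ (∈-upTo⁺ (s≤s i≤n)) (∈-cartesianProduct⁺ (∈-upTo⁺ (s≤s j≤n)) (∈-upTo⁺ (s≤s k≤n)))

  ∈-cube⁻ : ∀ {n} p → p ∈ cube n → InCube n p
  ∈-cube⁻ {n} _ p∈ with ∈-cartesianProduct⁻ (upTo (suc n)) _ p∈
  ... | i∈ , jk∈ with ∈-cartesianProduct⁻ (upTo (suc n)) (upTo (suc n)) jk∈
  ...   | j∈ , k∈ = ℕP.≤-pred (∈-upTo⁻ i∈) , ℕP.≤-pred (∈-upTo⁻ j∈) , ℕP.≤-pred (∈-upTo⁻ k∈)

  private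
    lexicographic : TotalOrder 0ℓ 0ℓ 0ℓ
    lexicographic = ×-totalOrder ℤP.≤-decTotalOrder ℤP.≤-totalOrder

  LexExtremum : ℕ → Array → Array → ℕ → ℕ → ℕ → Set
  LexExtremum n G Φ i j k =
    Σ[ a ∈ ℕ ] Σ[ b ∈ ℕ ] Σ[ c ∈ ℕ ] a ℕ.≤ n × b ℕ.≤ n × c ℕ.≤ n × G i j k ≤ G a b c
      × (∀ x y z → x ℕ.≤ n → y ℕ.≤ n → z ℕ.≤ n → G x y z ≤ G a b c)
      × (∀ x y z → x ℕ.≤ n → y ℕ.≤ n → z ℕ.≤ n → G x y z ≡ G a b c → Φ a b c ≤ Φ x y z)

  lexicographic-extremum : ∀ n G Φ {i j k} → i ℕ.≤ n → j ℕ.≤ n → k ℕ.≤ n → LexExtremum n G Φ i j k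
  lexicographic-extremum n G Φ {i} {j} {k} i≤n j≤n k≤n =
    a , b , c , proj₁ p∈ , proj₁ (proj₂ p∈) , proj₂ (proj₂ p∈) , G-max w (f[argmin]≤f[⊤] {f = key} w (cube n)) ,
    (λ x y z x≤n y≤n z≤n → G-max (x , y , z) (p≤ₗₑₓcube (x , y , z) (x≤n , y≤n , z≤n))) ,
    (λ x y z x≤n y≤n z≤n → Φ-min (x , y , z) (p≤ₗₑₓcube (x , y , z) (x≤n , y≤n , z≤n)))
    where
    open import Data.List.Extrema lexicographic
    open TotalOrder lexicographic using () renaming (_≤_ to _≤ₗₑₓ_)
    G′ Φ′ : Point → ℤ
    G′ (x , y , z) = G x y z
    Φ′ (x , y , z) = Φ x y z
    key : Point → ℤ × ℤ
    key q = - G′ q , Φ′ q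
    w = (i , j , k)
    p = argmin key w (cube n)
    a = proj₁ p
    b = proj₁ (proj₂ p)
    c = proj₂ (proj₂ p)
    p∈ : InCube n p
    p∈ = [ (λ p≡w → subst (InCube n) (sym p≡w) (i≤n , j≤n , k≤n)) , ∈-cube⁻ p ]′ (argmin-sel key w (cube n))
    p≤ₗₑₓcube : ∀ q → InCube n q → key p ≤ₗₑₓ key q
    p≤ₗₑₓcube q q∈ = lookup (f[argmin]≤f[xs] {f = key} w (cube n)) (∈-cube⁺ q q∈)
    G-max : ∀ q → key p ≤ₗₑₓ key q → G′ q ≤ G′ p
    G-max q (inj₁ (-Gp≤-Gq , _)) = ℤP.neg-cancel-≤ -Gp≤-Gq
    G-max q (inj₂ (-Gp≡-Gq , _)) = ℤP.≤-reflexive (sym (ℤP.neg-injective -Gp≡-Gq))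
    Φ-min : ∀ q → key p ≤ₗₑₓ key q → G′ q ≡ G′ p → Φ′ p ≤ Φ′ q
    Φ-min q (inj₁ (_ , -Gp≢-Gq)) Gq≡Gp = ⊥-elim (-Gp≢-Gq (cong -_ (sym Gq≡Gp)))
    Φ-min q (inj₂ (_ , Φp≤Φq)) _ = Φp≤Φq

  private
    δ-triple-cases : ∀ a b c i j k → δ a i * δ b j * δ c k ≡ 0ℤ ⊎ (δ a i * δ b j * δ c k ≡ 1ℤ × i ≡ a × j ≡ b × k ≡ c)
    δ-triple-cases a b c i j k with δ-product-cases a b i j | δ-cases c k
    ... | inj₁ X≡0 | _ rewrite X≡0 = inj₁ refl
    ... | inj₂ _ | inj₁ δ≡0 rewrite δ≡0 = inj₁ (ℤP.*-zeroʳ (δ a i * δ b j))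
    ... | inj₂ (X≡1 , i≡a , j≡b) | inj₂ (k≡c , δ≡1) rewrite X≡1 | δ≡1 = inj₂ (refl , i≡a , j≡b , k≡c)

    ∑-+-δ : ∀ {c m} (h : ℕ → ℤ) X → c ℕ.< m → ∑[ k < m ] (h k + X * δ c k) ≡ ∑ m h + X
    ∑-+-δ {c} {m} h X c<m = begin
      ∑[ k < m ] (h k + X * δ c k)       ≡⟨ ∑-distrib-+ m h (λ k → X * δ c k) ⟩
      ∑ m h + ∑[ k < m ] (X * δ c k)     ≡⟨ cong (λ s → ∑ m h + s) (*-distribˡ-∑ X m (δ c)) ⟨
      ∑ m h + X * ∑ m (δ c)              ≡⟨ cong (λ s → ∑ m h + X * s) (∑-δ c<m) ⟩
      ∑ m h + X * 1ℤ                     ≡⟨ cong (λ s → ∑ m h + s) (ℤP.*-identityʳ X) ⟩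
      ∑ m h + X                          ∎
      where open ≡-Reasoning

  module Raised {n f g a b c} (f-cs : IsCornerSumArray n f) (g-cs : IsCornerSumArray n g) (f≤g : f ≤[ n ] g)
           (a≤n : a ℕ.≤ n) (b≤n : b ℕ.≤ n) (c≤n : c ℕ.≤ n) (f<g : f a b c < g a b c)
           (gap-max : ∀ i j k → i ℕ.≤ n → j ℕ.≤ n → k ℕ.≤ n → gap f g i j k ≤ gap f g a b c)
           (φ-min : ∀ i j k → i ℕ.≤ n → j ℕ.≤ n → k ℕ.≤ n → gap f g i j k ≡ gap f g a b c → φ n f a b c ≤ φ n f i j k)
           where

    private
      module F = IsCornerSumArray f-cs
      module G = IsCornerSumArray g-cs

      interior-a = strict⇒interior F.axis₁ G.axis₁ b≤n c≤n a≤n f<g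
      interior-b = strict⇒interior F.axis₂ G.axis₂ a≤n c≤n b≤n f<g
      interior-c = strict⇒interior F.axis₃ G.axis₃ a≤n b≤n c≤n f<g
      0<a = proj₁ interior-a
      a<n = proj₂ interior-a
      0<b = proj₁ interior-b
      b<n = proj₂ interior-b
      0<c = proj₁ interior-c
      c<n = proj₂ interior-c

      reorder₂ : ∀ x p q r → x + p * q * r ≡ x + p * r * q
      reorder₂ = solve-∀
      reorder₁ : ∀ x p q r → x + p * q * r ≡ x + q * r * p
      reorder₁ = solve-∀
      weight₂ : ∀ N x p q r → N * x - p * q * r ≡ N * x - p * r * q
      weight₂ = solve-∀
      weight₁ : ∀ N x p q r → N * x - p * q * r ≡ N * x - q * r * p
      weight₁ = solve-∀

    bump-IsCornerSumArray : IsCornerSumArray n (bump a b c f)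
    bump-IsCornerSumArray = record
      { axis₁ = IsCornerSum₃-cong (λ i j k _ _ _ → sym (reorder₁ (f k i j) (δ a k) (δ b i) (δ c j)))
          (bump-IsCornerSum₃ F.axis₁ G.axis₁ 0<b b<n 0<c c<n 0<a a<n
            (λ k k≤n → gap-max k b c k≤n b≤n c≤n)
            (λ k k≤n eq → subst₂ _≤_ (weight₁ (+ n) (f a b c) (+ a) (+ b) (+ c)) (weight₁ (+ n) (f k b c) (+ k) (+ b) (+ c))
                            (φ-min k b c k≤n b≤n c≤n eq)))
      ; axis₂ = IsCornerSum₃-cong (λ i j k _ _ _ → sym (reorder₂ (f i k j) (δ a i) (δ b k) (δ c j)))
          (bump-IsCornerSum₃ F.axis₂ G.axis₂ 0<a a<n 0<c c<n 0<b b<n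
            (λ k k≤n → gap-max a k c a≤n k≤n c≤n)
            (λ k k≤n eq → subst₂ _≤_ (weight₂ (+ n) (f a b c) (+ a) (+ b) (+ c)) (weight₂ (+ n) (f a k c) (+ a) (+ k) (+ c))
                            (φ-min a k c a≤n k≤n c≤n eq)))
      ; axis₃ = bump-IsCornerSum₃ F.axis₃ G.axis₃ 0<a a<n 0<b b<n 0<c c<n
            (λ k k≤n → gap-max a b k a≤n b≤n k≤n) (λ k k≤n → φ-min a b k a≤n b≤n k≤n)
      }

    ≤-bump : f ≤[ n ] bump a b c f
    ≤-bump i j k _ _ _ with δ-triple-cases a b c i j k
    ... | inj₁ X≡0 rewrite X≡0 = ℤP.≤-reflexive (sym (ℤP.+-identityʳ (f i j k)))
    ... | inj₂ (X≡1 , _) rewrite X≡1 = ℤP.i≤i+j (f i j k) 1ℤ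

    bump-≤ : bump a b c f ≤[ n ] g
    bump-≤ i j k i≤n j≤n k≤n with δ-triple-cases a b c i j k
    ... | inj₁ X≡0 rewrite X≡0 | ℤP.+-identityʳ (f i j k) = f≤g i j k i≤n j≤n k≤n
    ... | inj₂ (X≡1 , refl , refl , refl) rewrite X≡1 = subst (_≤ g a b c) (ℤP.+-comm 1ℤ (f a b c)) (ℤP.i<j⇒suc[i]≤j f<g)

    σ-bump : σ n (bump a b c f) ≡ 1ℤ + σ n f
    σ-bump = begin
      ∑[ i < suc n ] ∑[ j < suc n ] ∑[ k < suc n ] (f i j k + δ a i * δ b j * δ c k)
        ≡⟨ ∑-cong {suc n} (λ i _ → ∑-cong {suc n} (λ j _ → ∑-+-δ (f i j) (δ a i * δ b j) (s≤s c≤n))) ⟩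
      ∑[ i < suc n ] ∑[ j < suc n ] (∑[ k < suc n ] f i j k + δ a i * δ b j)
        ≡⟨ ∑-cong {suc n} (λ i _ → ∑-+-δ (λ j → ∑[ k < suc n ] f i j k) (δ a i) (s≤s b≤n)) ⟩
      ∑[ i < suc n ] (∑[ j < suc n ] ∑[ k < suc n ] f i j k + δ a i)
        ≡⟨ ∑-cong {suc n} (λ i _ → cong (λ s → ∑[ j < suc n ] ∑[ k < suc n ] f i j k + s) (sym (ℤP.*-identityˡ (δ a i)))) ⟩
      ∑[ i < suc n ] (∑[ j < suc n ] ∑[ k < suc n ] f i j k + 1ℤ * δ a i)
        ≡⟨ ∑-+-δ (λ i → ∑[ j < suc n ] ∑[ k < suc n ] f i j k) 1ℤ (s≤s a≤n) ⟩
      σ n f + 1ℤ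
        ≡⟨ ℤP.+-comm (σ n f) 1ℤ ⟩
      1ℤ + σ n f ∎
      where open ≡-Reasoning

  private
    Δ-pos : ∀ {x y} → x < y → 0ℤ < y - x
    Δ-pos {x} {y} x<y = subst (_< y - x) (ℤP.+-inverseʳ x) (ℤP.+-monoˡ-< (- x) x<y)

    Δ-pos⁻ : ∀ {x y} → 0ℤ < y - x → x < y
    Δ-pos⁻ {x} {y} 0<Δ = subst₂ _<_ (ℤP.+-identityˡ x) (cancel x y) (ℤP.+-monoˡ-< x 0<Δ)
      where
      cancel : ∀ x y → y - x + x ≡ y
      cancel = solve-∀

  StepTowards : ℕ → Array → Array → Set
  StepTowards n f g = Σ[ e ∈ Array ] IsCornerSumArray n e × f ≤[ n ] e × e ≤[ n ] g × σ n e ≡ 1ℤ + σ n f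

  cover : ∀ {n f g} → IsCornerSumArray n f → IsCornerSumArray n g → f ≤[ n ] g → σ n f < σ n g → StepTowards n f g
  cover {n} {f} {g} f-cs g-cs f≤g σf<σg = from-entry (σ-<⇒∃< f≤g σf<σg)
    where
    from-extremum : ∀ {i j k} → f i j k < g i j k → LexExtremum n (gap f g) (φ n f) i j k → StepTowards n f g
    from-extremum f<g[ijk] (a , b , c , a≤n , b≤n , c≤n , gap[ijk]≤gap[abc] , gap-max , φ-min) =
      bump a b c f , bump-IsCornerSumArray , ≤-bump , bump-≤ , σ-bump
      where open Raised f-cs g-cs f≤g a≤n b≤n c≤n (Δ-pos⁻ (ℤP.<-≤-trans (Δ-pos f<g[ijk]) gap[ijk]≤gap[abc])) gap-max φ-min
    from-entry : Σ[ i ∈ ℕ ] Σ[ j ∈ ℕ ] Σ[ k ∈ ℕ ] i ℕ.≤ n × j ℕ.≤ n × k ℕ.≤ n × f i j k < g i j k → StepTowards n f g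
    from-entry (i , j , k , i≤n , j≤n , k≤n , f<g[ijk]) =
      from-extremum f<g[ijk] (lexicographic-extremum n (gap f g) (φ n f) i≤n j≤n k≤n)

module Gradedness where

  open import Data.Nat as ℕ using (ℕ; zero; suc)
  open import Data.Integer as ℤ using (ℤ; +_; _-_; _+_; 1ℤ; _≤_; _<_)
  import Data.Integer.Properties as ℤP
  open import Data.Integer.Tactic.RingSolver using (solve-∀)
  open import Data.Empty using (⊥; ⊥-elim)
  open import Data.List using (List; []; _∷_; _++_; [_]; length)
  import Data.List.Properties as ListP
  open import Data.List.Relation.Unary.All as All using (All; []; _∷_)
  import Data.List.Relation.Unary.All.Properties as AllP
  open import Data.List.Relation.Unary.Any using (Any; here; there)
  open import Data.List.Relation.Unary.AllPairs using (AllPairs; []; _∷_)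
  open import Data.List.Relation.Unary.Linked using (Linked; []; [-]; _∷_)
  open import Data.List.Relation.Unary.Linked.Properties using (Linked⇒AllPairs)
  open import Data.Product using (Σ-syntax; _×_; _,_; proj₁; proj₂)
  open import Data.Sum using (_⊎_; inj₁; inj₂)
  open import Relation.Nullary using (yes; no)
  open import Relation.Binary.PropositionalEquality hiding ([_])
  open import Defs

  module _ {n : ℕ} where

    ≤ᴴ-refl : {C : HyperMatrix n} → C ≤ᴴ C
    ≤ᴴ-refl i j k = ℤP.≤-refl

    ≤ᴴ-trans : {C D E : HyperMatrix n} → C ≤ᴴ D → D ≤ᴴ E → C ≤ᴴ E
    ≤ᴴ-trans C≤D D≤E i j k = ℤP.≤-trans (C≤D i j k) (D≤E i j k)

    ≤ᴴ-antisym : {C D : HyperMatrix n} → C ≤ᴴ D → D ≤ᴴ C → C ≈ᴴ D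
    ≤ᴴ-antisym C≤D D≤C i j k = ℤP.≤-antisym (C≤D i j k) (D≤C i j k)

    ≈ᴴ⇒≤ᴴ : {C D : HyperMatrix n} → C ≈ᴴ D → C ≤ᴴ D
    ≈ᴴ⇒≤ᴴ C≈D i j k = ℤP.≤-reflexive (C≈D i j k)

    ≈ᴴ⇒≥ᴴ : {C D : HyperMatrix n} → C ≈ᴴ D → D ≤ᴴ C
    ≈ᴴ⇒≥ᴴ C≈D i j k = ℤP.≤-reflexive (sym (C≈D i j k))

    <ᴴ-trans : {C D E : HyperMatrix n} → C <ᴴ D → D <ᴴ E → C <ᴴ E
    <ᴴ-trans (C≤D , D≰C) (D≤E , E≰D) = ≤ᴴ-trans C≤D D≤E , λ E≤C → E≰D (≤ᴴ-trans E≤C C≤D)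

  module Ranked
    (n : ℕ) (rank : HyperMatrix n → ℤ)
    (rank-mono : ∀ {C D} → C ≤ᴴ D → rank C ≤ rank D)
    (rank-≡⇒≥ᴴ : ∀ {C D} → C ≤ᴴ D → rank C ≡ rank D → D ≤ᴴ C)
    (bot top : HyperMatrix n) (bot-cs : IsCornerSum n bot) (top-cs : IsCornerSum n top)
    (bot-≤ : ∀ C → IsCornerSum n C → bot ≤ᴴ C) (≤-top : ∀ C → IsCornerSum n C → C ≤ᴴ top)
    (step : ∀ {C D} → IsCornerSum n C → IsCornerSum n D → C ≤ᴴ D → rank C < rank D →
            Σ[ E ∈ HyperMatrix n ] IsCornerSum n E × C ≤ᴴ E × E ≤ᴴ D × rank E ≡ 1ℤ + rank C)
    where

    private
      HM = HyperMatrix n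

      Comparable : HM → HM → Set
      Comparable D C = C ≤ᴴ D ⊎ D ≤ᴴ C

      rank-≈ : ∀ {C D} → C ≈ᴴ D → rank C ≡ rank D
      rank-≈ C≈D = ℤP.≤-antisym (rank-mono (≈ᴴ⇒≤ᴴ C≈D)) (rank-mono (≈ᴴ⇒≥ᴴ C≈D))

      rank-< : ∀ {C D} → C <ᴴ D → rank C < rank D
      rank-< (C≤D , D≰C) = ℤP.≤∧≢⇒< (rank-mono C≤D) (λ eq → D≰C (rank-≡⇒≥ᴴ C≤D eq))

      +-cancelʳ-≡ : ∀ {a c} b → a + b ≡ c + b → a ≡ c
      +-cancelʳ-≡ {a} {c} b eq = trans (restore a b) (trans (cong (_- b) eq) (sym (restore c b)))
        where
        restore : ∀ a b → a ≡ a + b - b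
        restore = solve-∀

      <1+ : ∀ x → x < 1ℤ + x
      <1+ x = ℤP.suc[i]≤j⇒i<j ℤP.≤-refl

      MaximalAbove : HM → List HM → Set
      MaximalAbove C cs = ∀ D → IsCornerSum n D → C ≤ᴴ D → All (Comparable D) cs → Any (_≈ᴴ D) cs

      ascend : ∀ d C → IsCornerSum n C → rank top ≡ + d + rank C →
               Σ[ cs ∈ List HM ] All (IsCornerSum n) (C ∷ cs) × Linked _<ᴴ_ (C ∷ cs) × length cs ≡ d × MaximalAbove C (C ∷ cs)
      ascend zero C C-cs top≡C = [] , C-cs ∷ [] , [-] , refl , at-top
        where
        at-top : MaximalAbove C (C ∷ [])
        at-top D D-cs C≤D _ = here (≤ᴴ-antisym C≤D (≤ᴴ-trans (≤-top D D-cs) (rank-≡⇒≥ᴴ (≤-top C C-cs) (trans (sym (ℤP.+-identityˡ (rank C))) (sym top≡C)))))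
      ascend (suc d) C C-cs top≡C with step C-cs top-cs (≤-top C C-cs) C<top
        where
        C<top : rank C < rank top
        C<top = subst (rank C <_) (trans (shift (+ d) (rank C)) (sym top≡C)) (ℤP.<-≤-trans (<1+ (rank C)) (ℤP.+-monoʳ-≤ 1ℤ (ℤP.i≤j+i (rank C) (+ d))))
          where
          shift : ∀ d x → 1ℤ + (d + x) ≡ 1ℤ + d + x
          shift = solve-∀
      ... | E , E-cs , C≤E , E≤top , E≡1+C with ascend d E E-cs (trans top≡C (trans (shift (+ d) (rank C)) (cong (λ x → + d + x) (sym E≡1+C))))
        where
        shift : ∀ d x → 1ℤ + d + x ≡ d + (1ℤ + x)
        shift = solve-∀
      ... | cs , all-cs , linked , length≡d , maximal-E = E ∷ cs , C-cs ∷ all-cs , C<E ∷ linked , cong suc length≡d , maximal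
        where
        C<E : C <ᴴ E
        C<E = C≤E , λ E≤C → ℤP.<⇒≱ (subst (rank C <_) (sym E≡1+C) (<1+ (rank C))) (rank-mono E≤C)
        maximal : MaximalAbove C (C ∷ E ∷ cs)
        maximal D D-cs C≤D (_ ∷ inj₁ E≤D ∷ rest) = there (maximal-E D D-cs E≤D (inj₁ E≤D ∷ rest))
        maximal D D-cs C≤D (_ ∷ inj₂ D≤E ∷ _) with rank D ℤP.≟ rank C
        ... | yes D≡C = here (≤ᴴ-antisym C≤D (rank-≡⇒≥ᴴ C≤D (sym D≡C)))
        ... | no  D≢C = there (here (≤ᴴ-antisym E≤D D≤E))
          where
          E≤D : E ≤ᴴ D
          E≤D = rank-≡⇒≥ᴴ D≤E (ℤP.≤-antisym (rank-mono D≤E)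
                  (subst (_≤ rank D) (sym E≡1+C) (ℤP.i<j⇒suc[i]≤j (ℤP.≤∧≢⇒< (rank-mono C≤D) (λ C≡D → D≢C (sym C≡D))))))

      Maximal : List HM → Set
      Maximal cs = ∀ D → IsCornerSum n D → All (Comparable D) cs → Any (_≈ᴴ D) cs

      consecutive : ∀ {cs x y} → Maximal cs → IsCornerSum n x → IsCornerSum n y → x <ᴴ y →
                    All (λ w → w ≤ᴴ x ⊎ y ≤ᴴ w) cs → rank y ≡ 1ℤ + rank x
      consecutive {cs} {x} {y} maximal x-cs y-cs x<y sandwich with rank y ℤP.≟ 1ℤ + rank x
      ... | yes y≡1+x = y≡1+x
      ... | no  y≢1+x with step x-cs y-cs (proj₁ x<y) (rank-< x<y)
      ...   | E , E-cs , x≤E , E≤y , E≡1+x = ⊥-elim (not-member (All.lookupAny sandwich (maximal E E-cs comparable)))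
        where
        comparable : All (Comparable E) cs
        comparable = All.map (λ { (inj₁ w≤x) → inj₁ (≤ᴴ-trans w≤x x≤E) ; (inj₂ y≤w) → inj₂ (≤ᴴ-trans E≤y y≤w) }) sandwich
        not-member : ∀ {w} → (w ≤ᴴ x ⊎ y ≤ᴴ w) × w ≈ᴴ E → ⊥
        not-member (inj₁ w≤x , w≈E) =
          ℤP.<⇒≱ (subst (rank x <_) (sym E≡1+x) (<1+ (rank x))) (subst (_≤ rank x) (rank-≈ w≈E) (rank-mono w≤x))
        not-member (inj₂ y≤w , w≈E) = y≢1+x (ℤP.≤-antisym
          (subst (rank y ≤_) (trans (rank-≈ w≈E) E≡1+x) (rank-mono y≤w)) (ℤP.i<j⇒suc[i]≤j (rank-< x<y)))

      last : HM → List HM → HM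
      last x []       = x
      last x (y ∷ ys) = last y ys

      ≤-last : ∀ x ys → AllPairs _<ᴴ_ (x ∷ ys) → All (_≤ᴴ last x ys) (x ∷ ys)
      ≤-last x []       _                = ≤ᴴ-refl ∷ []
      ≤-last x (y ∷ ys) ((x<y ∷ _) ∷ ordered) with ≤-last y ys ordered
      ... | y≤last ∷ rest = ≤ᴴ-trans (proj₁ x<y) y≤last ∷ y≤last ∷ rest

      last-cs : ∀ x ys → All (IsCornerSum n) (x ∷ ys) → IsCornerSum n (last x ys)
      last-cs x []       (x-cs ∷ _)  = x-cs
      last-cs x (y ∷ ys) (_ ∷ all-cs) = last-cs y ys all-cs

      walk : ∀ {cs} → Maximal cs → ∀ pre x ys → cs ≡ pre ++ x ∷ ys → All (_≤ᴴ x) pre →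
             AllPairs _<ᴴ_ (x ∷ ys) → All (IsCornerSum n) (x ∷ ys) → rank (last x ys) ≡ + length ys + rank x
      walk maximal pre x []       _  _      _                 _                = sym (ℤP.+-identityˡ (rank x))
      walk maximal pre x (y ∷ ys) eq pre≤x ((x<y ∷ _) ∷ ordered@(y<ys ∷ _)) (x-cs ∷ y-cs ∷ all-cs) = begin
        rank (last y ys)            ≡⟨ walk maximal (pre ++ [ x ]) y ys eq′ pre′≤y ordered (y-cs ∷ all-cs) ⟩
        + length ys + rank y        ≡⟨ cong (λ r → + length ys + r) (consecutive maximal x-cs y-cs x<y sandwich) ⟩
        + length ys + (1ℤ + rank x) ≡⟨ shift (+ length ys) (rank x) ⟩
        + suc (length ys) + rank x  ∎
        where
        open ≡-Reasoning
        shift : ∀ l r → l + (1ℤ + r) ≡ 1ℤ + l + r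
        shift = solve-∀
        eq′ = trans eq (sym (ListP.++-assoc pre [ x ] (y ∷ ys)))
        pre′≤y : All (_≤ᴴ y) (pre ++ [ x ])
        pre′≤y = AllP.++⁺ (All.map (λ w≤x → ≤ᴴ-trans w≤x (proj₁ x<y)) pre≤x) (proj₁ x<y ∷ [])
        sandwich = subst (All (λ w → w ≤ᴴ x ⊎ y ≤ᴴ w)) (sym eq)
          (AllP.++⁺ (All.map inj₁ pre≤x) (inj₁ ≤ᴴ-refl ∷ inj₂ ≤ᴴ-refl ∷ All.map (λ y<w → inj₂ (proj₁ y<w)) y<ys))

    maximal-chain-length : ∀ cs → IsMaximalChain n cs → rank top ≡ + chainLength cs + rank bot
    maximal-chain-length cs mc with IsMaximalChain.maximal mc bot bot-cs (All.map (λ {x} x-cs → inj₂ (bot-≤ x x-cs)) members)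
      where open IsChain (IsMaximalChain.chain mc)
    maximal-chain-length (c ∷ cs) mc | bot-member = begin
      rank top                  ≡⟨ top≡last ⟩
      rank (last c cs)          ≡⟨ walk maximal [] c cs refl [] ordered members ⟩
      + length cs + rank c      ≡⟨ cong (λ r → + length cs + r) c≡bot ⟩
      + length cs + rank bot    ∎
      where
      open ≡-Reasoning
      open IsMaximalChain mc
      open IsChain chain
      ordered : AllPairs _<ᴴ_ (c ∷ cs)
      ordered = Linked⇒AllPairs <ᴴ-trans increasing
      c≤cs : All (c ≤ᴴ_) (c ∷ cs)
      c≤cs with ordered
      ... | c<cs ∷ _ = ≤ᴴ-refl ∷ All.map proj₁ c<cs
      c≡bot : rank c ≡ rank bot
      c≡bot with All.lookupAny c≤cs bot-member
      ... | c≤w , w≈bot = ℤP.≤-antisym (subst (rank c ≤_) (rank-≈ w≈bot) (rank-mono c≤w)) (rank-mono (bot-≤ c (All.head members)))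
      top≡last : rank top ≡ rank (last c cs)
      top≡last with All.lookupAny (≤-last c cs ordered) (maximal top top-cs (All.map (λ {x} x-cs → inj₁ (≤-top x x-cs)) members))
      ... | w≤last , w≈top = ℤP.≤-antisym (subst (_≤ rank (last c cs)) (rank-≈ w≈top) (rank-mono w≤last))
                                           (rank-mono (≤-top _ (last-cs c cs members)))

    graded : Σ[ r ∈ ℕ ] GradedOfRank n r × rank top ≡ + r + rank bot
    graded =
      let cs , all-cs , linked , length≡d , maximal-bot = ascend d bot bot-cs top≡d+bot
          mc : IsMaximalChain n (bot ∷ cs)
          mc = record { chain = record { members = all-cs ; increasing = linked }
                      ; maximal = λ D D-cs comparable → maximal-bot D D-cs (bot-≤ D D-cs) comparable }
      in d , (((bot ∷ cs) , mc , length≡d) , every) , top≡d+bot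
      where
      d = ℤ.∣ rank top - rank bot ∣
      top≡d+bot : rank top ≡ + d + rank bot
      top≡d+bot = trans (split (rank bot) (rank top))
        (cong (_+ rank bot) (sym (ℤP.0≤i⇒+∣i∣≡i (ℤP.i≤j⇒0≤j-i (rank-mono (bot-≤ top top-cs))))))
        where
        split : ∀ b t → t ≡ (t - b) + b
        split = solve-∀
      every : ∀ cs → IsMaximalChain n cs → chainLength cs ≡ d
      every cs mc = ℤP.+-injective (+-cancelʳ-≡ (rank bot) (trans (sym (maximal-chain-length cs mc)) top≡d+bot))

module RankValue where

  open import Data.Nat as ℕ using (ℕ; zero; suc; _∸_; _⊓_; _⊔_; z≤n; s≤s)
  import Data.Nat.Properties as ℕP
  open import Data.Integer as ℤ using (ℤ; +_; -_; _-_; _+_; _*_; _^_; 0ℤ; 1ℤ; -1ℤ)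
  import Data.Integer.Properties as ℤP
  open import Data.Integer.Tactic.RingSolver using (solve-∀)
  import Data.Nat.Tactic.RingSolver as ℕS
  open import Data.Product using (Σ-syntax; _,_)
  open import Data.Sum using (_⊎_; inj₁; inj₂; [_,_]′)
  open import Defs using (rankNumerator)
  open import Relation.Binary.PropositionalEquality
  open Sums
  open TruncatedSubtraction
  open MinimalEntries
  open Arrays
  open Extremes

  ∑-affine : ∀ A B C m → + 2 * ∑[ t < m ] (A * (B + C * + t)) ≡ + m * (A * (+ 2 * B - C + C * + m))
  ∑-affine A B C m = trans (*-distribˡ-∑ (+ 2) m _) (telescope (λ y → y * (A * (+ 2 * B - C + C * y))) refl (difference A B C) m)
    where
    difference : ∀ A B C x → let G y = y * (A * (+ 2 * B - C + C * y)) in + 2 * (A * (B + C * x)) ≡ G (1ℤ + x) - G x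
    difference = solve-∀

  ∑-quadratic : ∀ A N m → + 6 * ∑[ t < m ] (A * (1ℤ + A + + t) * (N - (1ℤ + A + + t)))
                ≡ + m * (A * (+ 3 * N * (1ℤ + + m) - 1ℤ - + 3 * + m - + 2 * + m * + m + + 6 * A * (N - 1ℤ - + m - A)))
  ∑-quadratic A N m = trans (*-distribˡ-∑ (+ 6) m _)
    (telescope (λ y → y * (A * (+ 3 * N * (1ℤ + y) - 1ℤ - + 3 * y - + 2 * y * y + + 6 * A * (N - 1ℤ - y - A)))) refl (difference A N) m)
    where
    difference : ∀ A N x → let G y = y * (A * (+ 3 * N * (1ℤ + y) - 1ℤ - + 3 * y - + 2 * y * y + + 6 * A * (N - 1ℤ - y - A))) in
                 + 6 * (A * (1ℤ + A + x) * (N - (1ℤ + A + x))) ≡ G (1ℤ + x) - G x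
    difference = solve-∀

  ∑-quartic-low : ∀ N m {T} → T ≡ + m →
    + 20 * ∑[ t < m ] (+ t * + t * + t * + t - + 3 * N * (+ t * + t * + t) + + 2 * (+ t * + t) - N * + t + N * N * N * + t)
    ≡ T * ((T - 1ℤ) * (+ 14 * T + + 15 * N * T - + 6 * (T * T) - + 15 * N * (T * T) + + 4 * (T * T * T) - + 6 - + 10 * N + + 10 * (N * N * N)))
  ∑-quartic-low N m refl = trans (*-distribˡ-∑ (+ 20) m _)
    (telescope (λ y → y * ((y - 1ℤ) * (+ 14 * y + + 15 * N * y - + 6 * (y * y) - + 15 * N * (y * y) + + 4 * (y * y * y) - + 6 - + 10 * N + + 10 * (N * N * N)))) refl (difference N) m)
    where
    difference : ∀ N x → let G y = y * ((y - 1ℤ) * (+ 14 * y + + 15 * N * y - + 6 * (y * y) - + 15 * N * (y * y) + + 4 * (y * y * y) - + 6 - + 10 * N + + 10 * (N * N * N))) in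
                 + 20 * ((x * x * x * x) - + 3 * N * (x * x * x) + + 2 * (x * x) - N * x + (N * N * N) * x) ≡ G (1ℤ + x) - G x
    difference = solve-∀

  ∑-quartic-high : ∀ N m {T} → T ≡ + m →
    + 60 * ∑[ t < m ] ((N - + t) * (+ t * + t * + t))
    ≡ T * ((T - 1ℤ) * (+ 15 * N * T * (T - 1ℤ) - + 2 * (+ 2 * T - 1ℤ) * (+ 3 * (T * T) - + 3 * T - 1ℤ)))
  ∑-quartic-high N m refl = trans (*-distribˡ-∑ (+ 60) m _)
    (telescope (λ y → y * ((y - 1ℤ) * (+ 15 * N * y * (y - 1ℤ) - + 2 * (+ 2 * y - 1ℤ) * (+ 3 * (y * y) - + 3 * y - 1ℤ)))) refl (difference N) m)
    where
    difference : ∀ N x → let G y = y * ((y - 1ℤ) * (+ 15 * N * y * (y - 1ℤ) - + 2 * (+ 2 * y - 1ℤ) * (+ 3 * (y * y) - + 3 * y - 1ℤ))) in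
                 + 60 * ((N - x) * (x * x * x)) ≡ G (1ℤ + x) - G x
    difference = solve-∀

  private
    pos-∸ : ∀ {m n} → n ℕ.≤ m → + (m ∸ n) ≡ + m - + n
    pos-∸ {m} {n} n≤m = trans (sym (ℤP.⊖-≥ n≤m)) (sym (ℤP.m-n≡m⊖n m n))

  fibreGap : ℕ → ℕ → ℕ → ℤ
  fibreGap n a b = + suc n * (+ a * + b) - + 2 * ∑[ k < suc n ] (+ cminSorted n a b k)

  fibreGap-low : ∀ {n} a b → a ℕ.+ b ℕ.≤ n → fibreGap n a b ≡ + a * + b * (+ n - + b)
  fibreGap-low {n} a b a+b≤n = begin
    + suc n * (+ a * + b) - + 2 * ∑[ k < suc n ] (+ cminSorted n a b k)
      ≡⟨ cong (λ s → + suc n * (+ a * + b) - + 2 * s) column ⟩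
    + suc n * (+ a * + b) - + 2 * (0ℤ + ∑[ t < suc b ] (+ a * (0ℤ + 1ℤ * + t)))
      ≡⟨ cong (λ s → + suc n * (+ a * + b) - + 2 * s) (ℤP.+-identityˡ _) ⟩
    + suc n * (+ a * + b) - + 2 * ∑[ t < suc b ] (+ a * (0ℤ + 1ℤ * + t))
      ≡⟨ cong (λ s → + suc n * (+ a * + b) - s) (∑-affine (+ a) 0ℤ 1ℤ (suc b)) ⟩
    + suc n * (+ a * + b) - + suc b * (+ a * (+ 2 * 0ℤ - 1ℤ + 1ℤ * + suc b))
      ≡⟨ simplify (+ n) (+ a) (+ b) ⟩
    + a * + b * (+ n - + b) ∎
    where
    open ≡-Reasoning
    b≤n = ℕP.≤-trans (ℕP.m≤n+m b a) a+b≤n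
    simplify : ∀ N A B → (1ℤ + N) * (A * B) - (1ℤ + B) * (A * (+ 2 * 0ℤ - 1ℤ + 1ℤ * (1ℤ + B))) ≡ A * B * (N - B)
    simplify = solve-∀
    vanishing : ∀ k → k ℕ.< n ∸ b → + cminSorted n a b k ≡ 0ℤ
    vanishing k k<n∸b = cong +_ (trans (cminSorted-low a b k a+b≤n)
      (trans (cong (a ℕ.*_) (ℕP.m≤n⇒m∸n≡0 (ℕP.≤-trans (ℕP.+-monoʳ-≤ b (ℕP.<⇒≤ k<n∸b)) (ℕP.≤-reflexive (ℕP.m+[n∸m]≡n b≤n)))))
             (ℕP.*-zeroʳ a)))
    linear : ∀ t → t ℕ.< suc b → + cminSorted n a b (n ∸ b ℕ.+ t) ≡ + a * (0ℤ + 1ℤ * + t)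
    linear t _ = begin
      + cminSorted n a b (n ∸ b ℕ.+ t)     ≡⟨ cong +_ (cminSorted-low a b _ a+b≤n) ⟩
      + (a ℕ.* (b ℕ.+ (n ∸ b ℕ.+ t) ∸ n))  ≡⟨ cong (λ x → + (a ℕ.* x)) (∸-by n (trans (sym (ℕP.+-assoc b (n ∸ b) t)) (cong (ℕ._+ t) (ℕP.m+[n∸m]≡n b≤n)))) ⟩
      + (a ℕ.* t)                          ≡⟨ ℤP.pos-* a t ⟩
      + a * + t                            ≡⟨ cong (+ a *_) (sym (trans (ℤP.+-identityˡ _) (ℤP.*-identityˡ (+ t)))) ⟩
      + a * (0ℤ + 1ℤ * + t)                ∎
    column : ∑[ k < suc n ] (+ cminSorted n a b k) ≡ 0ℤ + ∑[ t < suc b ] (+ a * (0ℤ + 1ℤ * + t))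
    column = begin
      ∑[ k < suc n ] (+ cminSorted n a b k)
        ≡⟨ cong (λ m → ∑[ k < m ] (+ cminSorted n a b k)) (trans (cong suc (sym (ℕP.m∸n+n≡m b≤n))) (sym (ℕP.+-suc (n ∸ b) b))) ⟩
      ∑[ k < n ∸ b ℕ.+ suc b ] (+ cminSorted n a b k)
        ≡⟨ ∑-split (n ∸ b) (suc b) _ ⟩
      ∑[ k < n ∸ b ] (+ cminSorted n a b k) + ∑[ t < suc b ] (+ cminSorted n a b (n ∸ b ℕ.+ t))
        ≡⟨ cong₂ _+_ (∑-zero vanishing) (∑-cong linear) ⟩
      0ℤ + ∑[ t < suc b ] (+ a * (0ℤ + 1ℤ * + t)) ∎

  fibreGap-high : ∀ {n} a b → a ℕ.≤ b → b ℕ.≤ n → n ℕ.≤ a ℕ.+ b → fibreGap n a b ≡ + a * (+ n - + a) * (+ n - + b)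
  fibreGap-high {n} a b a≤b b≤n n≤a+b = begin
    + suc n * (+ a * + b) - + 2 * ∑[ k < suc n ] (+ cminSorted n a b k)
      ≡⟨ cong (λ s → + suc n * (+ a * + b) - + 2 * s) column ⟩
    + suc n * (+ a * + b) - + 2 * (S₁ + S₂)
      ≡⟨ cong (λ s → + suc n * (+ a * + b) - s) (ℤP.*-distribˡ-+ (+ 2) S₁ S₂) ⟩
    + suc n * (+ a * + b) - (+ 2 * S₁ + + 2 * S₂)
      ≡⟨ cong₂ (λ u v → + suc n * (+ a * + b) - (u + v)) (∑-affine L 0ℤ 1ℤ (suc a)) (∑-affine (+ a) (L + 1ℤ) 1ℤ (n ∸ a)) ⟩
    + suc n * (+ a * + b) - (+ suc a * (L * (+ 2 * 0ℤ - 1ℤ + 1ℤ * + suc a)) + + (n ∸ a) * (+ a * (+ 2 * (L + 1ℤ) - 1ℤ + 1ℤ * + (n ∸ a))))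
      ≡⟨ cong (λ d → + suc n * (+ a * + b) - (+ suc a * (L * (+ 2 * 0ℤ - 1ℤ + 1ℤ * + suc a)) + d * (+ a * (+ 2 * (L + 1ℤ) - 1ℤ + 1ℤ * d)))) (pos-∸ a≤n) ⟩
    + suc n * (+ a * + b) - (+ suc a * (L * (+ 2 * 0ℤ - 1ℤ + 1ℤ * + suc a)) + (+ n - + a) * (+ a * (+ 2 * (L + 1ℤ) - 1ℤ + 1ℤ * (+ n - + a))))
      ≡⟨ simplify (+ n) (+ a) (+ b) ⟩
    + a * (+ n - + a) * (+ n - + b) ∎
    where
    open ≡-Reasoning
    a≤n = ℕP.≤-trans a≤b b≤n
    L = + a + + b - + n
    S₁ = ∑[ k < suc a ] (L * (0ℤ + 1ℤ * + k))
    S₂ = ∑[ t < n ∸ a ] (+ a * (L + 1ℤ + 1ℤ * + t))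
    simplify : ∀ N A B → let L = A + B - N in
      (1ℤ + N) * (A * B) - ((1ℤ + A) * (L * (+ 2 * 0ℤ - 1ℤ + 1ℤ * (1ℤ + A))) + (N - A) * (A * (+ 2 * (L + 1ℤ) - 1ℤ + 1ℤ * (N - A))))
      ≡ A * (N - A) * (N - B)
    simplify = solve-∀
    excess : + (a ℕ.+ b ∸ n) ≡ L
    excess = pos-∸ n≤a+b
    rising : ∀ k → k ℕ.< suc a → + cminSorted n a b k ≡ L * (0ℤ + 1ℤ * + k)
    rising k k<1+a = begin
      + cminSorted n a b k               ≡⟨ cong +_ (cminSorted-≤a a b k b≤n (ℕP.≤-pred k<1+a)) ⟩
      + (k ℕ.* (a ℕ.+ b ∸ n))            ≡⟨ ℤP.pos-* k _ ⟩
      + k * + (a ℕ.+ b ∸ n)              ≡⟨ cong (+ k *_) excess ⟩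
      + k * L                            ≡⟨ reshape (+ k) L ⟩
      L * (0ℤ + 1ℤ * + k)                ∎
      where
      reshape : ∀ K L → K * L ≡ L * (0ℤ + 1ℤ * K)
      reshape = solve-∀
    steady : ∀ t → t ℕ.< n ∸ a → + cminSorted n a b (suc a ℕ.+ t) ≡ + a * (L + 1ℤ + 1ℤ * + t)
    steady t _ = begin
      + cminSorted n a b (suc a ℕ.+ t)                 ≡⟨ cong +_ (cminSorted-≥a a b (suc a ℕ.+ t) b≤n (ℕP.≤-trans (ℕP.n≤1+n a) (ℕP.m≤m+n (suc a) t))) ⟩
      + (a ℕ.* (b ℕ.+ (suc a ℕ.+ t) ∸ n))              ≡⟨ cong (λ x → + (a ℕ.* (x ∸ n))) (shift a b t) ⟩
      + (a ℕ.* (a ℕ.+ b ℕ.+ suc t ∸ n))                ≡⟨ cong (λ x → + (a ℕ.* x)) (ℕP.+-∸-comm (suc t) n≤a+b) ⟩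
      + (a ℕ.* (a ℕ.+ b ∸ n ℕ.+ suc t))                ≡⟨ ℤP.pos-* a _ ⟩
      + a * (+ (a ℕ.+ b ∸ n) + + suc t)                ≡⟨ cong (λ x → + a * (x + + suc t)) excess ⟩
      + a * (L + + suc t)                              ≡⟨ reshape (+ a) L (+ t) ⟩
      + a * (L + 1ℤ + 1ℤ * + t)                        ∎
      where
      shift : ∀ a b t → b ℕ.+ (suc a ℕ.+ t) ≡ a ℕ.+ b ℕ.+ suc t
      shift = ℕS.solve-∀
      reshape : ∀ A L T → A * (L + (1ℤ + T)) ≡ A * (L + 1ℤ + 1ℤ * T)
      reshape = solve-∀
    column : ∑[ k < suc n ] (+ cminSorted n a b k) ≡ S₁ + S₂
    column = begin
      ∑[ k < suc n ] (+ cminSorted n a b k)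
        ≡⟨ cong (λ m → ∑[ k < m ] (+ cminSorted n a b k)) (cong suc (sym (ℕP.m+[n∸m]≡n a≤n))) ⟩
      ∑[ k < suc a ℕ.+ (n ∸ a) ] (+ cminSorted n a b k)
        ≡⟨ ∑-split (suc a) (n ∸ a) _ ⟩
      ∑[ k < suc a ] (+ cminSorted n a b k) + ∑[ t < n ∸ a ] (+ cminSorted n a b (suc a ℕ.+ t))
        ≡⟨ cong₂ _+_ (∑-cong rising) (∑-cong steady) ⟩
      S₁ + S₂ ∎

  ∑-symmetric : ∀ (h : ℕ → ℕ → ℤ) N →
    ∑[ i < N ] ∑[ j < N ] h (i ⊓ j) (i ⊔ j) ≡ ∑[ a < N ] (h a a + + 2 * ∑[ t < N ∸ suc a ] h a (suc a ℕ.+ t))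
  ∑-symmetric h zero    = refl
  ∑-symmetric h (suc N) = begin
    ∑[ i < N ] (∑[ j < N ] h′ i j + h′ i N) + (∑[ j < N ] h′ N j + h′ N N)
      ≡⟨ cong (_+ (∑[ j < N ] h′ N j + h′ N N)) (∑-distrib-+ N (λ i → ∑[ j < N ] h′ i j) (λ i → h′ i N)) ⟩
    ∑[ i < N ] ∑[ j < N ] h′ i j + ∑[ i < N ] h′ i N + (∑[ j < N ] h′ N j + h′ N N)
      ≡⟨ cong₂ (λ u v → u + v + (∑[ j < N ] h′ N j + h′ N N)) (∑-symmetric h N) (∑-cong below) ⟩
    R N + X + (∑[ j < N ] h′ N j + h′ N N)
      ≡⟨ cong₂ (λ u v → R N + X + (u + v)) (∑-cong beside) (cong₂ h (ℕP.⊓-idem N) (ℕP.⊔-idem N)) ⟩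
    R N + X + (X + h N N)
      ≡⟨ regroup (R N) X (h N N) ⟩
    (R N + + 2 * X) + (h N N + + 2 * 0ℤ)
      ≡⟨ cong₂ _+_ (sym (trans (∑-cong extend) (trans (∑-distrib-+ N _ _) (cong (λ s → R N + s) (sym (*-distribˡ-∑ (+ 2) N _))))))
                   (cong (λ m → h N N + + 2 * ∑[ t < m ] h N (suc N ℕ.+ t)) (sym (ℕP.n∸n≡0 N))) ⟩
    ∑[ a < N ] (h a a + + 2 * ∑[ t < N ∸ a ] h a (suc a ℕ.+ t)) + (h N N + + 2 * ∑[ t < N ∸ N ] h N (suc N ℕ.+ t)) ∎
    where
    open ≡-Reasoning
    h′ = λ i j → h (i ⊓ j) (i ⊔ j)
    R = λ N → ∑[ a < N ] (h a a + + 2 * ∑[ t < N ∸ suc a ] h a (suc a ℕ.+ t))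
    X = ∑[ a < N ] h a N
    regroup : ∀ R X Y → R + X + (X + Y) ≡ (R + + 2 * X) + (Y + + 2 * 0ℤ)
    regroup = solve-∀
    below : ∀ i → i ℕ.< N → h′ i N ≡ h i N
    below i i<N = cong₂ h (ℕP.m≤n⇒m⊓n≡m (ℕP.<⇒≤ i<N)) (ℕP.m≤n⇒m⊔n≡n (ℕP.<⇒≤ i<N))
    beside : ∀ j → j ℕ.< N → h′ N j ≡ h j N
    beside j j<N = cong₂ h (ℕP.m≥n⇒m⊓n≡n (ℕP.<⇒≤ j<N)) (ℕP.m≥n⇒m⊔n≡m (ℕP.<⇒≤ j<N))
    extend : ∀ a → a ℕ.< N → h a a + + 2 * ∑[ t < N ∸ a ] h a (suc a ℕ.+ t)
                             ≡ (h a a + + 2 * ∑[ t < N ∸ suc a ] h a (suc a ℕ.+ t)) + + 2 * h a N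
    extend a a<N = begin
      h a a + + 2 * ∑[ t < N ∸ a ] g t
        ≡⟨ cong (λ m → h a a + + 2 * ∑[ t < m ] g t) (ℕP.+-∸-assoc 1 a<N) ⟩
      h a a + + 2 * (∑[ t < N ∸ suc a ] g t + g (N ∸ suc a))
        ≡⟨ cong (λ x → h a a + + 2 * (∑[ t < N ∸ suc a ] g t + h a x)) (ℕP.m+[n∸m]≡n a<N) ⟩
      h a a + + 2 * (∑[ t < N ∸ suc a ] g t + h a N)
        ≡⟨ distribute (h a a) (∑[ t < N ∸ suc a ] g t) (h a N) ⟩
      (h a a + + 2 * ∑[ t < N ∸ suc a ] g t) + + 2 * h a N ∎
      where
      g = λ t → h a (suc a ℕ.+ t)
      distribute : ∀ A S X → A + + 2 * (S + X) ≡ A + + 2 * S + + 2 * X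
      distribute = solve-∀

  rowGap : ℕ → ℕ → ℤ
  rowGap n a = fibreGap n a a + + 2 * ∑[ t < n ∸ a ] fibreGap n a (suc a ℕ.+ t)

  rowGap-high : ∀ {n a} → a ℕ.≤ n → n ℕ.≤ a ℕ.+ a → rowGap n a ≡ + a * ((+ n - + a) * (+ n - + a) * (+ n - + a))
  rowGap-high {n} {a} a≤n n≤2a = begin
    fibreGap n a a + + 2 * ∑[ t < n ∸ a ] fibreGap n a (suc a ℕ.+ t)
      ≡⟨ cong₂ (λ u v → u + + 2 * v) (fibreGap-high a a ℕP.≤-refl a≤n n≤2a) (∑-cong descending) ⟩
    + a * (+ n - + a) * (+ n - + a) + + 2 * ∑[ t < n ∸ a ] (+ a * (+ n - + a) * (+ n - + a - 1ℤ + -1ℤ * + t))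
      ≡⟨ cong (λ s → + a * (+ n - + a) * (+ n - + a) + s) (∑-affine (+ a * (+ n - + a)) (+ n - + a - 1ℤ) -1ℤ (n ∸ a)) ⟩
    + a * (+ n - + a) * (+ n - + a) + + (n ∸ a) * (+ a * (+ n - + a) * (+ 2 * (+ n - + a - 1ℤ) - -1ℤ + -1ℤ * + (n ∸ a)))
      ≡⟨ cong (λ d → + a * (+ n - + a) * (+ n - + a) + d * (+ a * (+ n - + a) * (+ 2 * (+ n - + a - 1ℤ) - -1ℤ + -1ℤ * d))) (pos-∸ a≤n) ⟩
    + a * (+ n - + a) * (+ n - + a) + (+ n - + a) * (+ a * (+ n - + a) * (+ 2 * (+ n - + a - 1ℤ) - -1ℤ + -1ℤ * (+ n - + a)))
      ≡⟨ simplify (+ n) (+ a) ⟩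
    + a * ((+ n - + a) * (+ n - + a) * (+ n - + a)) ∎
    where
    open ≡-Reasoning
    simplify : ∀ N A → A * (N - A) * (N - A) + (N - A) * (A * (N - A) * (+ 2 * (N - A - 1ℤ) - -1ℤ + -1ℤ * (N - A)))
                       ≡ A * ((N - A) * (N - A) * (N - A))
    simplify = solve-∀
    reshape : ∀ A N T → A * (N - A) * (N - (1ℤ + A + T)) ≡ A * (N - A) * (N - A - 1ℤ + -1ℤ * T)
    reshape = solve-∀
    descending : ∀ t → t ℕ.< n ∸ a → fibreGap n a (suc a ℕ.+ t) ≡ + a * (+ n - + a) * (+ n - + a - 1ℤ + -1ℤ * + t)
    descending t t<n∸a = trans (fibreGap-high a (suc a ℕ.+ t) a≤b b≤n n≤a+b) (reshape (+ a) (+ n) (+ t))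
      where
      a≤b = ℕP.≤-trans (ℕP.n≤1+n a) (ℕP.m≤m+n (suc a) t)
      b≤n = ℕP.≤-trans (ℕP.+-monoʳ-< a t<n∸a) (ℕP.≤-reflexive (ℕP.m+[n∸m]≡n a≤n))
      n≤a+b = ℕP.≤-trans n≤2a (ℕP.+-monoʳ-≤ a a≤b)

  rowGap-low : ∀ {n a N} → N ≡ + n → a ℕ.+ a ℕ.≤ n →
    + 3 * rowGap n a ≡ + a * + a * + a * + a - + 3 * N * (+ a * + a * + a) + + 2 * (+ a * + a) - N * + a + N * N * N * + a
  rowGap-low {n} {a} refl 2a≤n with ≤-split 2a≤n
  ... | L , refl = begin
    + 3 * (fibreGap n a a + + 2 * ∑[ t < n ∸ a ] F t)
      ≡⟨ cong (λ m → + 3 * (fibreGap n a a + + 2 * ∑[ t < m ] F t)) (∸-by a (shift a L)) ⟩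
    + 3 * (fibreGap n a a + + 2 * ∑[ t < L ℕ.+ a ] F t)
      ≡⟨ cong (λ s → + 3 * (fibreGap n a a + + 2 * s)) (∑-split L a F) ⟩
    + 3 * (fibreGap n a a + + 2 * (∑[ t < L ] F t + ∑[ s < a ] F (L ℕ.+ s)))
      ≡⟨ cong₂ (λ x s → + 3 * (x + + 2 * s)) (fibreGap-low a a 2a≤n) (cong₂ _+_ (∑-cong ascending) (∑-cong descending)) ⟩
    + 3 * (X + + 2 * (S₁ + S₂))
      ≡⟨ regroup X S₁ S₂ ⟩
    + 3 * X + + 6 * S₁ + + 3 * (+ 2 * S₂)
      ≡⟨ cong₂ (λ u v → + 3 * X + u + + 3 * v) (∑-quadratic (+ a) (+ n) L) (∑-affine A′ B -1ℤ a) ⟩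
    + 3 * X + + L * (+ a * (+ 3 * + n * (1ℤ + + L) - 1ℤ - + 3 * + L - + 2 * + L * + L + + 6 * + a * (+ n - 1ℤ - + L - + a)))
      + + 3 * (+ a * (A′ * (+ 2 * B - -1ℤ + -1ℤ * + a)))
      ≡⟨ simplify (+ a) (+ L) ⟩
    + a * + a * + a * + a - + 3 * + n * (+ a * + a * + a) + + 2 * (+ a * + a) - + n * + a + + n * + n * + n * + a ∎
    where
    open ≡-Reasoning
    F = λ t → fibreGap n a (suc a ℕ.+ t)
    X = + a * + a * (+ n - + a)
    A′ = + a * (+ n - + a)
    B = + n - + a - 1ℤ - + L
    S₁ = ∑[ t < L ] (+ a * (1ℤ + + a + + t) * (+ n - (1ℤ + + a + + t)))
    S₂ = ∑[ s < a ] (A′ * (B + -1ℤ * + s))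
    shift : ∀ a L → a ℕ.+ a ℕ.+ L ≡ a ℕ.+ (L ℕ.+ a)
    shift = ℕS.solve-∀
    regroup : ∀ X S₁ S₂ → + 3 * (X + + 2 * (S₁ + S₂)) ≡ + 3 * X + + 6 * S₁ + + 3 * (+ 2 * S₂)
    regroup = solve-∀
    simplify : ∀ A L → let N = A + A + L in
      + 3 * (A * A * (N - A)) + L * (A * (+ 3 * N * (1ℤ + L) - 1ℤ - + 3 * L - + 2 * L * L + + 6 * A * (N - 1ℤ - L - A)))
        + + 3 * (A * (A * (N - A) * (+ 2 * (N - A - 1ℤ - L) - -1ℤ + -1ℤ * A)))
      ≡ A * A * A * A - + 3 * N * (A * A * A) + + 2 * (A * A) - N * A + N * N * N * A
    simplify = solve-∀
    reshape : ∀ A N L S → A * (N - A) * (N - (1ℤ + A + (L + S))) ≡ A * (N - A) * (N - A - 1ℤ - L + -1ℤ * S)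
    reshape = solve-∀
    ascending : ∀ t → t ℕ.< L → F t ≡ + a * (1ℤ + + a + + t) * (+ n - (1ℤ + + a + + t))
    ascending t t<L = fibreGap-low a (suc a ℕ.+ t) (ℕP.≤-trans (ℕP.≤-reflexive (reorder a t)) (ℕP.+-monoʳ-≤ (a ℕ.+ a) t<L))
      where
      reorder : ∀ a t → a ℕ.+ (suc a ℕ.+ t) ≡ a ℕ.+ a ℕ.+ suc t
      reorder = ℕS.solve-∀
    descending : ∀ s → s ℕ.< a → F (L ℕ.+ s) ≡ A′ * (B + -1ℤ * + s)
    descending s s<a = trans (fibreGap-high a b a≤b b≤n n≤a+b) (reshape (+ a) (+ n) (+ L) (+ s))
      where
      b = suc a ℕ.+ (L ℕ.+ s)
      a≤b = ℕP.≤-trans (ℕP.n≤1+n a) (ℕP.m≤m+n (suc a) (L ℕ.+ s))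
      b≤n = ℕP.≤-trans (ℕP.≤-reflexive (reorder₁ a L s)) (ℕP.≤-trans (ℕP.+-monoʳ-≤ (a ℕ.+ L) s<a) (ℕP.≤-reflexive (reorder₃ a L)))
        where
        reorder₁ : ∀ a L s → suc a ℕ.+ (L ℕ.+ s) ≡ a ℕ.+ L ℕ.+ suc s
        reorder₁ = ℕS.solve-∀
        reorder₃ : ∀ a L → a ℕ.+ L ℕ.+ a ≡ a ℕ.+ a ℕ.+ L
        reorder₃ = ℕS.solve-∀
      n≤a+b = ≤-by (suc s) (reorder₂ a L s)
        where
        reorder₂ : ∀ a L s → a ℕ.+ a ℕ.+ L ℕ.+ suc s ≡ a ℕ.+ (suc a ℕ.+ (L ℕ.+ s))
        reorder₂ = ℕS.solve-∀

  private
    pos-+-cancel : ∀ x y {z} → x ℕ.+ y ≡ z → + z - + y ≡ + x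
    pos-+-cancel x y refl = cancel (+ x) (+ y)
      where
      cancel : ∀ x y → x + y - y ≡ x
      cancel = solve-∀

  ∑-rowGap-low : ∀ {m n N} → N ≡ + n → m ℕ.+ m ℕ.≤ n → + 3 * ∑[ a < suc m ] rowGap n a
    ≡ ∑[ a < suc m ] (+ a * + a * + a * + a - + 3 * N * (+ a * + a * + a) + + 2 * (+ a * + a) - N * + a + N * N * N * + a)
  ∑-rowGap-low {m} {n} N≡n 2m≤n = trans (*-distribˡ-∑ (+ 3) (suc m) (rowGap n))
    (∑-cong {suc m} λ a a<1+m → rowGap-low {n} {a} N≡n (ℕP.≤-trans (ℕP.+-mono-≤ (ℕP.≤-pred a<1+m) (ℕP.≤-pred a<1+m)) 2m≤n))

  ∑-rowGap-high : ∀ {m m′ N} → N ≡ + (m ℕ.+ m′) → m ℕ.≤ m′ → m′ ℕ.≤ suc m →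
    ∑[ t < m′ ] rowGap (m ℕ.+ m′) (suc m ℕ.+ t) ≡ ∑[ c < m′ ] ((N - + c) * (+ c * + c * + c))
  ∑-rowGap-high {m} {m′} refl m≤m′ m′≤1+m = trans (sym (∑-reverse m′ _)) (∑-cong reflected)
    where
    n = m ℕ.+ m′
    reflected : ∀ c → c ℕ.< m′ → rowGap n (suc m ℕ.+ (m′ ∸ suc c)) ≡ (+ n - + c) * (+ c * + c * + c)
    reflected c c<m′ = trans (rowGap-high {n} {a} a≤n n≤2a) (cong₂ (λ x y → x * (y * y * y)) (sym (pos-+-cancel a c a+c≡n)) (pos-+-cancel c a (trans (ℕP.+-comm c a) a+c≡n)))
      where
      a = suc m ℕ.+ (m′ ∸ suc c)
      a+c≡n : a ℕ.+ c ≡ n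
      a+c≡n = begin
        suc m ℕ.+ (m′ ∸ suc c) ℕ.+ c     ≡⟨ cong suc (ℕP.+-assoc m (m′ ∸ suc c) c) ⟩
        suc (m ℕ.+ ((m′ ∸ suc c) ℕ.+ c)) ≡⟨ ℕP.+-suc m _ ⟨
        m ℕ.+ (suc (m′ ∸ suc c) ℕ.+ c)   ≡⟨ cong (λ x → m ℕ.+ (x ℕ.+ c)) (ℕP.+-∸-assoc 1 c<m′) ⟨
        m ℕ.+ ((m′ ∸ c) ℕ.+ c)           ≡⟨ cong (m ℕ.+_) (ℕP.m∸n+n≡m (ℕP.<⇒≤ c<m′)) ⟩
        n                                ∎
        where open ≡-Reasoning
      a≤n = ℕP.≤-trans (ℕP.m≤m+n a c) (ℕP.≤-reflexive a+c≡n)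
      1+m≤a = ℕP.m≤m+n (suc m) (m′ ∸ suc c)
      n≤2a = ℕP.≤-trans (ℕP.+-mono-≤ (ℕP.n≤1+n m) m′≤1+m) (ℕP.+-mono-≤ 1+m≤a 1+m≤a)

  ∑-rowGap-closed : ∀ {m m′ M M′} → M ≡ + m → M′ ≡ + m′ → m ℕ.≤ m′ → m′ ℕ.≤ suc m → let T = 1ℤ + M; N = M + M′ in
    + 240 * ∑[ a < suc (m ℕ.+ m′) ] rowGap (m ℕ.+ m′) a
    ≡ + 4 * (T * ((T - 1ℤ) * (+ 14 * T + + 15 * N * T - + 6 * (T * T) - + 15 * N * (T * T) + + 4 * (T * T * T) - + 6 - + 10 * N + + 10 * (N * N * N))))
      + + 4 * (M′ * ((M′ - 1ℤ) * (+ 15 * N * M′ * (M′ - 1ℤ) - + 2 * (+ 2 * M′ - 1ℤ) * (+ 3 * (M′ * M′) - + 3 * M′ - 1ℤ))))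
  ∑-rowGap-closed {m} {m′} refl refl m≤m′ m′≤1+m = begin
    + 240 * ∑[ a < suc m ℕ.+ m′ ] rowGap n a
      ≡⟨ cong (+ 240 *_) (∑-split (suc m) m′ (rowGap n)) ⟩
    + 240 * (Low + High)
      ≡⟨ regroup Low High ⟩
    + 4 * (+ 20 * (+ 3 * Low)) + + 4 * (+ 60 * High)
      ≡⟨ cong₂ (λ u v → + 4 * (+ 20 * u) + + 4 * (+ 60 * v)) (∑-rowGap-low {m} {n} refl 2m≤n) (∑-rowGap-high {m} {m′} refl m≤m′ m′≤1+m) ⟩
    + 4 * (+ 20 * ∑[ a < suc m ] (+ a * + a * + a * + a - + 3 * N * (+ a * + a * + a) + + 2 * (+ a * + a) - N * + a + N * N * N * + a))
      + + 4 * (+ 60 * ∑[ c < m′ ] ((N - + c) * (+ c * + c * + c)))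
      ≡⟨ cong₂ (λ u v → + 4 * u + + 4 * v) (∑-quartic-low N (suc m) refl) (∑-quartic-high N m′ refl) ⟩
    _ ∎
    where
    open ≡-Reasoning
    n = m ℕ.+ m′
    N = + m + + m′
    Low = ∑[ a < suc m ] rowGap n a
    High = ∑[ t < m′ ] rowGap n (suc m ℕ.+ t)
    2m≤n = ℕP.+-monoʳ-≤ m m≤m′
    regroup : ∀ L H → + 240 * (L + H) ≡ + 4 * (+ 20 * (+ 3 * L)) + + 4 * (+ 60 * H)
    regroup = solve-∀

  private
    parity : ∀ n → (Σ[ m ∈ ℕ ] n ≡ m ℕ.+ m) ⊎ (Σ[ m ∈ ℕ ] n ≡ m ℕ.+ suc m)
    parity zero = inj₁ (zero , refl)
    parity (suc n) with parity n
    ... | inj₁ (m , refl) = inj₂ (m , sym (ℕP.+-suc m m))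
    ... | inj₂ (m , refl) = inj₁ (suc m , refl)

    [-1]^[m+m]≡1 : ∀ m → (- + 1) ^ (m ℕ.+ m) ≡ + 1
    [-1]^[m+m]≡1 zero    = refl
    [-1]^[m+m]≡1 (suc m) rewrite ℕP.+-suc m m = cong (λ x → -1ℤ * (-1ℤ * x)) ([-1]^[m+m]≡1 m)

    [-1]^[m+1+m]≡-1 : ∀ m → (- + 1) ^ (m ℕ.+ suc m) ≡ - + 1
    [-1]^[m+1+m]≡-1 m rewrite ℕP.+-suc m m = cong (-1ℤ *_) ([-1]^[m+m]≡1 m)

    rankNumerator-even : ∀ m → let N = + m + + m in
      rankNumerator (m ℕ.+ m) ≡ + 9 * (N * (N * (N * (N * (N * 1ℤ))))) - + 10 * (N * (N * (N * 1ℤ))) + + 16 * N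
    rankNumerator-even m rewrite [-1]^[m+m]≡1 m = refl

    rankNumerator-odd : ∀ m → let N = + m + (1ℤ + + m) in
      rankNumerator (m ℕ.+ suc m) ≡ + 9 * (N * (N * (N * (N * (N * 1ℤ))))) - + 10 * (N * (N * (N * 1ℤ))) + + 1 * N
    rankNumerator-odd m rewrite [-1]^[m+1+m]≡-1 m = refl

  private
    closed-even : ∀ M → let T = 1ℤ + M; M′ = M; N = M + M′ in
      + 4 * (T * ((T - 1ℤ) * (+ 14 * T + + 15 * N * T - + 6 * (T * T) - + 15 * N * (T * T) + + 4 * (T * T * T) - + 6 - + 10 * N + + 10 * (N * N * N))))
        + + 4 * (M′ * ((M′ - 1ℤ) * (+ 15 * N * M′ * (M′ - 1ℤ) - + 2 * (+ 2 * M′ - 1ℤ) * (+ 3 * (M′ * M′) - + 3 * M′ - 1ℤ))))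
      ≡ + 9 * (N * (N * (N * (N * (N * 1ℤ))))) - + 10 * (N * (N * (N * 1ℤ))) + + 16 * N
    closed-even = solve-∀

    closed-odd : ∀ M → let T = 1ℤ + M; M′ = 1ℤ + M; N = M + M′ in
      + 4 * (T * ((T - 1ℤ) * (+ 14 * T + + 15 * N * T - + 6 * (T * T) - + 15 * N * (T * T) + + 4 * (T * T * T) - + 6 - + 10 * N + + 10 * (N * N * N))))
        + + 4 * (M′ * ((M′ - 1ℤ) * (+ 15 * N * M′ * (M′ - 1ℤ) - + 2 * (+ 2 * M′ - 1ℤ) * (+ 3 * (M′ * M′) - + 3 * M′ - 1ℤ))))
      ≡ + 9 * (N * (N * (N * (N * (N * 1ℤ))))) - + 10 * (N * (N * (N * 1ℤ))) + + 1 * N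
    closed-odd = solve-∀

  ∑-rowGap-even : ∀ m → + 240 * ∑[ a < suc (m ℕ.+ m) ] rowGap (m ℕ.+ m) a ≡ rankNumerator (m ℕ.+ m)
  ∑-rowGap-even m = trans (∑-rowGap-closed {m} {m} {+ m} {+ m} refl refl ℕP.≤-refl (ℕP.n≤1+n m))
    (trans (closed-even (+ m)) (sym (rankNumerator-even m)))

  ∑-rowGap-odd : ∀ m → + 240 * ∑[ a < suc (m ℕ.+ suc m) ] rowGap (m ℕ.+ suc m) a ≡ rankNumerator (m ℕ.+ suc m)
  ∑-rowGap-odd m = trans (∑-rowGap-closed {m} {suc m} {+ m} {1ℤ + + m} refl refl (ℕP.n≤1+n m) ℕP.≤-refl)
    (trans (closed-odd (+ m)) (sym (rankNumerator-odd m)))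

  ∑-rowGap : ∀ n → + 240 * ∑[ a < suc n ] rowGap n a ≡ rankNumerator n
  ∑-rowGap n = [ (λ (m , n≡m+m) → subst Goal (sym n≡m+m) (∑-rowGap-even m))
               , (λ (m , n≡m+1+m) → subst Goal (sym n≡m+1+m) (∑-rowGap-odd m)) ]′ (parity n)
    where
    Goal : ℕ → Set
    Goal n = + 240 * ∑[ a < suc n ] rowGap n a ≡ rankNumerator n

  ∑-Cmax-Cmin : ∀ {n i j} → i ℕ.≤ n → j ℕ.≤ n → ∑[ k < suc n ] (Cmax n i j k - Cmin n i j k) ≡ fibreGap n (i ⊓ j) (i ⊔ j)
  ∑-Cmax-Cmin {n} {i} {j} i≤n j≤n = begin
    ∑[ k < suc n ] (+ (i ℕ.* j) - c (n ∸ k) - c k)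
      ≡⟨ ∑-distrib-- (suc n) (λ k → + (i ℕ.* j) - c (n ∸ k)) c ⟩
    ∑[ k < suc n ] (+ (i ℕ.* j) - c (n ∸ k)) - S
      ≡⟨ cong (_- S) (∑-distrib-- (suc n) (λ _ → + (i ℕ.* j)) (λ k → c (n ∸ k))) ⟩
    ∑[ _ < suc n ] (+ (i ℕ.* j)) - ∑[ k < suc n ] c (n ∸ k) - S
      ≡⟨ cong₂ (λ u v → u - v - S) (∑-const (suc n) (+ (i ℕ.* j))) (∑-reverse (suc n) c) ⟩
    + suc n * + (i ℕ.* j) - S - S
      ≡⟨ twice (+ suc n * + (i ℕ.* j)) S ⟩
    + suc n * + (i ℕ.* j) - + 2 * S
      ≡⟨ cong₂ (λ u v → + suc n * u - + 2 * v) product (∑-cong λ k k<1+n → cong +_ (cmin-sorted i≤n j≤n (ℕP.≤-pred k<1+n))) ⟩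
    fibreGap n (i ⊓ j) (i ⊔ j) ∎
    where
    open ≡-Reasoning
    c = λ k → + cmin n i j k
    S = ∑[ k < suc n ] c k
    twice : ∀ X S → X - S - S ≡ X - + 2 * S
    twice = solve-∀
    product : + (i ℕ.* j) ≡ + (i ⊓ j) * + (i ⊔ j)
    product = trans (cong +_ (sym (i⊓j*i⊔j≡i*j i j))) (ℤP.pos-* (i ⊓ j) (i ⊔ j))

  σ-Cmax-Cmin : ∀ n → + 240 * (σ n (Cmax n) - σ n (Cmin n)) ≡ rankNumerator n
  σ-Cmax-Cmin n = begin
    + 240 * (σ n (Cmax n) - σ n (Cmin n))
      ≡⟨ cong (+ 240 *_) (σ-distrib-- n (Cmax n) (Cmin n)) ⟩
    + 240 * ∑[ i < suc n ] ∑[ j < suc n ] ∑[ k < suc n ] (Cmax n i j k - Cmin n i j k)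
      ≡⟨ cong (+ 240 *_) (∑-cong {suc n} λ i i<1+n → ∑-cong {suc n} λ j j<1+n → ∑-Cmax-Cmin (ℕP.≤-pred i<1+n) (ℕP.≤-pred j<1+n)) ⟩
    + 240 * ∑[ i < suc n ] ∑[ j < suc n ] fibreGap n (i ⊓ j) (i ⊔ j)
      ≡⟨ cong (+ 240 *_) (∑-symmetric (fibreGap n) (suc n)) ⟩
    + 240 * ∑[ a < suc n ] rowGap n a
      ≡⟨ ∑-rowGap n ⟩
    rankNumerator n ∎
    where open ≡-Reasoning

open import Defs
open import Data.Nat using (ℕ; _≥_)
open import Data.Integer using (+_; _*_)
open import Data.Product using (Σ; _×_)
open import Relation.Binary.PropositionalEquality using (_≡_)

open import Data.Integer as ℤ using (ℤ; _-_; _+_; 1ℤ)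
import Data.Integer.Properties as ℤP
open import Data.Integer.Tactic.RingSolver using (solve-∀)
open import Data.Product using (Σ-syntax; _,_)
open import Relation.Binary.PropositionalEquality using (refl; sym; trans; cong; cong₂)
open Arrays
open Extremes
open Covering
open Gradedness
open RankValue

module _ (n : ℕ) where

  rank : HyperMatrix n → ℤ
  rank C = σ n (toArray C)

  rank-mono : ∀ {C D} → C ≤ᴴ D → rank C ℤ.≤ rank D
  rank-mono C≤D = σ-mono-≤ (toArray-mono C≤D)

  rank-≡⇒≥ᴴ : ∀ {C D} → C ≤ᴴ D → rank C ≡ rank D → D ≤ᴴ C
  rank-≡⇒≥ᴴ C≤D eq = toArray-reflects-≤ λ i j k i≤n j≤n k≤n →
    ℤP.≤-reflexive (sym (σ-≡⇒≈ (toArray-mono C≤D) eq i j k i≤n j≤n k≤n))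

  bot top : HyperMatrix n
  bot = fromArray (Cmin n)
  top = fromArray (Cmax n)

  rank-fromArray : ∀ f → rank (fromArray f) ≡ σ n f
  rank-fromArray f = σ-cong {n} (toArray-fromArray f)

  bot-≤ : ∀ C → IsCornerSum n C → bot ≤ᴴ C
  bot-≤ C C-cs = fromArray-≤ᴴ (Cmin-≤ (IsCornerSumArray.axis₃ (IsCornerSum⇒IsCornerSumArray C-cs)))

  ≤-top : ∀ C → IsCornerSum n C → C ≤ᴴ top
  ≤-top C C-cs = ≤ᴴ-fromArray (≤-Cmax (IsCornerSumArray.axis₃ (IsCornerSum⇒IsCornerSumArray C-cs)))

  step : ∀ {C D} → IsCornerSum n C → IsCornerSum n D → C ≤ᴴ D → rank C ℤ.< rank D →
         Σ[ E ∈ HyperMatrix n ] IsCornerSum n E × C ≤ᴴ E × E ≤ᴴ D × rank E ≡ 1ℤ + rank C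
  step {C} {D} C-cs D-cs C≤D C<D =
    lift (cover (IsCornerSum⇒IsCornerSumArray C-cs) (IsCornerSum⇒IsCornerSumArray D-cs) (toArray-mono C≤D) C<D)
    where
    lift : StepTowards n (toArray C) (toArray D) →
           Σ[ E ∈ HyperMatrix n ] IsCornerSum n E × C ≤ᴴ E × E ≤ᴴ D × rank E ≡ 1ℤ + rank C
    lift (e , e-cs , C≤e , e≤D , e≡1+C) =
      fromArray e , IsCornerSumArray⇒IsCornerSum e-cs , ≤ᴴ-fromArray C≤e , fromArray-≤ᴴ e≤D , trans (rank-fromArray e) e≡1+C

  open Ranked n rank rank-mono rank-≡⇒≥ᴴ bot top
    (IsCornerSumArray⇒IsCornerSum (Cmin-IsCornerSumArray n)) (IsCornerSumArray⇒IsCornerSum (Cmax-IsCornerSumArray n))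
    bot-≤ ≤-top step public

mainTheorem6 : (n : ℕ) → n ≥ 1 →
    Σ ℕ (λ r → GradedOfRank n r × (+ 240) * (+ r) ≡ rankNumerator n)
mainTheorem6 n _ = conclude (graded n)
  where
  difference : ∀ {r} → rank n (top n) ≡ + r + rank n (bot n) → + r ≡ σ n (Cmax n) - σ n (Cmin n)
  difference {r} eq = trans (cancel (+ r) (rank n (bot n))) (cong₂ _-_ (trans (sym eq) (rank-fromArray n (Cmax n))) (rank-fromArray n (Cmin n)))
    where
    cancel : ∀ r b → r ≡ r + b - b
    cancel = solve-∀
  conclude : Σ[ r ∈ ℕ ] GradedOfRank n r × rank n (top n) ≡ + r + rank n (bot n) →
             Σ ℕ (λ r → GradedOfRank n r × (+ 240) * (+ r) ≡ rankNumerator n)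
  conclude (r , graded-r , top≡r+bot) = r , graded-r , trans (cong (+ 240 *_) (difference top≡r+bot)) (σ-Cmax-Cmin n)
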